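{- Fix integers $1\leq s\leq t$, a constant $\delta>0$ and a subgraph $L$ of $K_{s,t}$. Let $G$ be a graph with $n$ vertices and at least $n^{2-1/t+\delta}$ edges, and let $\lambda$ be defined by saying that $G$ contains exactly $\lambda n^{s+t}$ labelled copies of $K_{s,t}$. Then $G$ contains at most $(1+o(1))\lambda^{e(L)/(st)}n^{v(L)}$ labelled copies of $L$, where the $o(1)$ term tends to $0$ as $n\to\infty$ (depending only on $s,t,\delta,L$).
   Context: A labelled copy of a graph $F$ in $G$ is an injective map $\phi:V(F)\to V(G)$ such that $\phi(u)\phi(v)\in E(G)$ for every $uv\in E(F)$. $e(L)$ and $v(L)$ denote the numbers of edges and vertices of $L$. -}

module Defs where

open import Data.Nat using (ℕ; zero; suc; _+_; _<ᵇ_)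
open import Data.Bool using (Bool; true; false; _∧_; _∨_; not; if_then_else_)
open import Data.Fin using (Fin; toℕ; _↑ˡ_; _↑ʳ_)
open import Data.Fin.Properties using (_≟_)
open import Data.List using (List; []; _∷_; map; concatMap; allFin; foldr)
open import Data.Vec using (Vec; lookup) renaming ([] to []v; _∷_ to _∷v_)
open import Relation.Nullary.Decidable using (⌊_⌋)
open import Relation.Binary.PropositionalEquality using (_≡_)

record Graph (n : ℕ) : Set where
  field
    adj    : Fin n → Fin n → Bool
    sym    : ∀ i j → adj i j ≡ adj j i
    irrefl : ∀ i → adj i i ≡ false
open Graph public

andL : {A : Set} → (A → Bool) → List A → Bool
andL p = foldr (λ x r → p x ∧ r) true

countL : {A : Set} → (A → Bool) → List A → ℕ
countL p = foldr (λ x r → if p x then suc r else r) 0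

sumL : {A : Set} → (A → ℕ) → List A → ℕ
sumL f = foldr (λ x r → f x + r) 0

edgeCount : {n : ℕ} → Graph n → ℕ
edgeCount {n} G =
  sumL (λ i → countL (λ j → (toℕ i <ᵇ toℕ j) ∧ adj G i j) (allFin n)) (allFin n)

allVecs : (k n : ℕ) → List (Vec (Fin n) k)
allVecs zero    n = []v ∷ []
allVecs (suc k) n = concatMap (λ x → map (x ∷v_) (allVecs k n)) (allFin n)

injectiveᵇ : {k n : ℕ} → Vec (Fin n) k → Bool
injectiveᵇ {k} v =
  andL (λ i → andL (λ j → ⌊ i ≟ j ⌋ ∨ not ⌊ lookup v i ≟ lookup v j ⌋) (allFin k)) (allFin k)

-- A subgraph L of K_{s,t} is given by a ≤ s vertices on the left side,
-- b ≤ t vertices on the right side, and an edge set E ⊆ Fin a × Fin b.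
-- Its vertex set is Fin (a + b): left vertex i is  i ↑ˡ b, right vertex j is  a ↑ʳ j.
BipEdges : ℕ → ℕ → Set
BipEdges a b = Fin a → Fin b → Bool

bipEdgeCount : {a b : ℕ} → BipEdges a b → ℕ
bipEdgeCount {a} {b} E = sumL (λ i → countL (λ j → E i j) (allFin b)) (allFin a)

preservesᵇ : {a b n : ℕ} → Graph n → BipEdges a b → Vec (Fin n) (a + b) → Bool
preservesᵇ {a} {b} G E v =
  andL (λ i → andL (λ j → not (E i j) ∨ adj G (lookup v (i ↑ˡ b)) (lookup v (a ↑ʳ j)))
                   (allFin b)) (allFin a)

labelledCopies : {n : ℕ} → Graph n → (a b : ℕ) → BipEdges a b → ℕ
labelledCopies {n} G a b E =
  countL (λ v → injectiveᵇ v ∧ preservesᵇ G E v) (allVecs (a + b) n)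

completeBip : (s t : ℕ) → BipEdges s t
completeBip s t i j = true

module Submission where

-- Count homomorphisms instead of copies.  Writing hom(L) as a sum over left tuples x of the product,
-- over right vertices j, of the number of extensions of x to j, Hölder's inequality with exponent t
-- (padding L with t − b isolated right vertices) bounds hom(L)^t by a product of column sums; a second
-- Hölder step with exponent s, over right tuples, bounds each column sum by hom(K_{s,t}) or by a power
-- of n, giving hom(L)^{st} n^{e(L)(s+t)} ≤ hom(K_{s,t})^{e(L)} n^{v(L)st}.  As copies(L) ≤ hom(L), it
-- remains to see that almost every homomorphism of K_{s,t} is injective.  For every K, those that
-- identify two given vertices number at most (K^t n^t + hom(K_{s,t}))/K, while the power-mean
-- inequality gives e(G)^{st} ≤ hom(K_{s,t}) n^{2st−s−t}; by the density assumption this makes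
-- hom(K_{s,t}) ≥ K^t n^t as soon as n ≥ K^{tq}.

open import Defs
open import Data.Nat using (ℕ; _+_; _*_; _∸_; _^_; _≤_; _<_)
open import Data.Product using (∃-syntax)

open import Data.Nat
open import Data.Nat.Properties
open import Data.Nat.DivMod using (_%_; m<n⇒m%n≡m; [m+n]%n≡m%n)
open import Data.Nat.Tactic.RingSolver using (solve-∀)
open import Data.Bool using (Bool; true; false; _∧_; _∨_; not; if_then_else_)
open import Data.Bool.Properties using (∧-commutativeMonoid)
open import Algebra.Bundles using (CommutativeMonoid)
open import Algebra.Properties.CommutativeSemigroup +-commutativeSemigroup
  using () renaming (interchange to +-interchange)
open import Algebra.Properties.CommutativeSemigroup *-commutativeSemigroup
  using () renaming (interchange to *-interchange; xy∙z≈xz∙y to *-right-comm; x∙yz≈y∙xz to *-left-comm)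
open import Algebra.Properties.CommutativeSemigroup (CommutativeMonoid.commutativeSemigroup ∧-commutativeMonoid)
  using () renaming (interchange to ∧-interchange)
open import Data.List using (List; []; _∷_; map; concatMap; _++_; length; allFin; tabulate)
open import Data.List.Properties using (length-tabulate)
open import Data.Vec using (Vec; lookup) renaming ([] to []v; _∷_ to _∷v_; _++_ to _++v_)
open import Data.Vec.Properties using (lookup-++ˡ; lookup-++ʳ)
open import Data.Fin using (Fin; _↑ˡ_; _↑ʳ_; splitAt; toℕ) renaming (zero to fz; suc to fs)
open import Data.Fin.Properties using (splitAt⁻¹-↑ˡ; splitAt⁻¹-↑ʳ) renaming (_≟_ to _≟F_)
open import Data.Sum using (inj₁; inj₂)
open import Data.Product using (_,_)
open import Data.Empty using (⊥-elim)
open import Relation.Nullary using (yes; no)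
open import Relation.Nullary.Decidable using (⌊_⌋)
open import Function using (_∘_)
open import Relation.Binary.PropositionalEquality renaming (sym to ≡-sym)

open ≤-Reasoning

private variable
  A B : Set

^-distribʳ-* : ∀ x y k → (x * y) ^ k ≡ x ^ k * y ^ k
^-distribʳ-* x y zero    = refl
^-distribʳ-* x y (suc k) rewrite ^-distribʳ-* x y k = *-interchange x y (x ^ k) (y ^ k)

^-cancelˡ-≤ : ∀ k {a b} → a ^ suc k ≤ b ^ suc k → a ≤ b
^-cancelˡ-≤ k {a} {b} aᵏ≤bᵏ with a ≤? b
... | yes a≤b = a≤b
... | no  a≰b = ⊥-elim (<⇒≱ (^-monoˡ-< (suc k) (≰⇒> a≰b)) aᵏ≤bᵏ)

^-monoʳ-suc : ∀ K {k l} → k ≤ l → K ^ suc k ≤ K ^ suc l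
^-monoʳ-suc zero    _   = z≤n
^-monoʳ-suc (suc K) k≤l = ^-monoʳ-≤ (suc K) (s≤s k≤l)

*-≤0 : ∀ K {c} B → c ≤ 0 → K * c ≤ B
*-≤0 K B c≤0 = ≤-trans (*-monoʳ-≤ K c≤0) (≤-trans (≤-reflexive (*-zeroʳ K)) z≤n)

*-^-≤ : ∀ K c k → K * c ^ k ≤ K ^ suc k + c ^ suc k
*-^-≤ K c k with ≤-total c K
... | inj₁ c≤K = ≤-trans (*-monoʳ-≤ K (^-monoˡ-≤ k c≤K)) (m≤m+n _ _)
... | inj₂ K≤c = ≤-trans (*-monoˡ-≤ (c ^ k) K≤c) (m≤n+m _ _)

*-^-mono-≤ : ∀ {m M H C} e k → e ≤ k → m ≤ M → m * H ≤ M * C → m ^ k * H ^ e ≤ M ^ k * C ^ e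
*-^-mono-≤ {m} {M} {H} {C} e k e≤k m≤M mH≤MC with m≤n⇒∃[o]m+o≡n e≤k
... | r , refl = begin
  m ^ (e + r) * H ^ e     ≡⟨ cong (_* H ^ e) (trans (^-distribˡ-+-* m e r) (*-comm (m ^ e) _)) ⟩
  m ^ r * m ^ e * H ^ e   ≡⟨ trans (*-assoc (m ^ r) _ _) (cong (m ^ r *_) (≡-sym (^-distribʳ-* m H e))) ⟩
  m ^ r * (m * H) ^ e     ≤⟨ *-mono-≤ (^-monoˡ-≤ r m≤M) (^-monoˡ-≤ e mH≤MC) ⟩
  M ^ r * (M * C) ^ e     ≡⟨ cong (M ^ r *_) (^-distribʳ-* M C e) ⟩
  M ^ r * (M ^ e * C ^ e) ≡⟨ *-assoc (M ^ r) (M ^ e) (C ^ e) ⟨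
  M ^ r * M ^ e * C ^ e   ≡⟨ cong (_* C ^ e) (trans (*-comm (M ^ r) (M ^ e)) (≡-sym (^-distribˡ-+-* M e r))) ⟩
  M ^ (e + r) * C ^ e ∎

sumL-cong : ∀ {f g : A → ℕ} xs → (∀ x → f x ≡ g x) → sumL f xs ≡ sumL g xs
sumL-cong []       f≡g = refl
sumL-cong (x ∷ xs) f≡g = cong₂ _+_ (f≡g x) (sumL-cong xs f≡g)

sumL-mono : ∀ {f g : A → ℕ} xs → (∀ x → f x ≤ g x) → sumL f xs ≤ sumL g xs
sumL-mono []       f≤g = z≤n
sumL-mono (x ∷ xs) f≤g = +-mono-≤ (f≤g x) (sumL-mono xs f≤g)

sumL-+ : ∀ (f g : A → ℕ) xs → sumL (λ x → f x + g x) xs ≡ sumL f xs + sumL g xs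
sumL-+ f g []       = refl
sumL-+ f g (x ∷ xs) rewrite sumL-+ f g xs = +-interchange (f x) (g x) (sumL f xs) (sumL g xs)

sumL-*ˡ : ∀ c (f : A → ℕ) xs → sumL (λ x → c * f x) xs ≡ c * sumL f xs
sumL-*ˡ c f []       = ≡-sym (*-zeroʳ c)
sumL-*ˡ c f (x ∷ xs) rewrite sumL-*ˡ c f xs = ≡-sym (*-distribˡ-+ c (f x) (sumL f xs))

sumL-*ʳ : ∀ c (f : A → ℕ) xs → sumL (λ x → f x * c) xs ≡ sumL f xs * c
sumL-*ʳ c f xs = trans (sumL-cong xs (λ x → *-comm (f x) c)) (trans (sumL-*ˡ c f xs) (*-comm c _))

sumL-const : ∀ c (xs : List A) → sumL (λ _ → c) xs ≡ length xs * c
sumL-const c []       = refl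
sumL-const c (x ∷ xs) = cong (c +_) (sumL-const c xs)

sumL-zero : ∀ {f : A → ℕ} xs → (∀ x → f x ≡ 0) → sumL f xs ≡ 0
sumL-zero xs f≡0 = trans (sumL-cong xs f≡0) (trans (sumL-const 0 xs) (*-zeroʳ (length xs)))

sumL-++ : ∀ (f : A → ℕ) xs ys → sumL f (xs ++ ys) ≡ sumL f xs + sumL f ys
sumL-++ f []       ys = refl
sumL-++ f (x ∷ xs) ys rewrite sumL-++ f xs ys = ≡-sym (+-assoc (f x) _ _)

sumL-map : ∀ (f : B → ℕ) (g : A → B) xs → sumL f (map g xs) ≡ sumL (f ∘ g) xs
sumL-map f g []       = refl
sumL-map f g (x ∷ xs) = cong (f (g x) +_) (sumL-map f g xs)

sumL-concatMap : ∀ (f : B → ℕ) (g : A → List B) xs →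
  sumL f (concatMap g xs) ≡ sumL (λ x → sumL f (g x)) xs
sumL-concatMap f g []       = refl
sumL-concatMap f g (x ∷ xs) =
  trans (sumL-++ f (g x) (concatMap g xs)) (cong (sumL f (g x) +_) (sumL-concatMap f g xs))

sumL-swap : ∀ (f : A → B → ℕ) xs ys →
  sumL (λ x → sumL (f x) ys) xs ≡ sumL (λ y → sumL (λ x → f x y) xs) ys
sumL-swap f []       ys = ≡-sym (sumL-zero ys (λ _ → refl))
sumL-swap f (x ∷ xs) ys rewrite sumL-swap f xs ys =
  ≡-sym (sumL-+ (f x) (λ y → sumL (λ x → f x y) xs) ys)

ind : Bool → ℕ
ind true  = 1
ind false = 0

ind-∧ : ∀ a b → ind (a ∧ b) ≡ ind a * ind b
ind-∧ true  b = ≡-sym (+-identityʳ _)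
ind-∧ false b = refl

ind≤1 : ∀ a → ind a ≤ 1
ind≤1 true  = ≤-refl
ind≤1 false = z≤n

countL≡sumL-ind : ∀ (p : A → Bool) xs → countL p xs ≡ sumL (ind ∘ p) xs
countL≡sumL-ind p [] = refl
countL≡sumL-ind p (x ∷ xs) with p x
... | true  = cong suc (countL≡sumL-ind p xs)
... | false = countL≡sumL-ind p xs

countL-cong : ∀ {p q : A → Bool} xs → (∀ x → p x ≡ q x) → countL p xs ≡ countL q xs
countL-cong {p = p} {q} xs p≡q = begin-equality
  countL p xs          ≡⟨ countL≡sumL-ind p xs ⟩
  sumL (ind ∘ p) xs    ≡⟨ sumL-cong xs (cong ind ∘ p≡q) ⟩
  sumL (ind ∘ q) xs    ≡⟨ countL≡sumL-ind q xs ⟨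
  countL q xs          ∎

countL-split : ∀ (q p : A → Bool) xs →
  countL p xs ≡ countL (λ v → q v ∧ p v) xs + countL (λ v → not (q v) ∧ p v) xs
countL-split q p [] = refl
countL-split q p (x ∷ xs) with q x | p x
... | true  | true  = cong suc (countL-split q p xs)
... | false | true  = trans (cong suc (countL-split q p xs)) (≡-sym (+-suc _ _))
... | true  | false = countL-split q p xs
... | false | false = countL-split q p xs

countL-∧≤ : ∀ (q p : A → Bool) xs → countL (λ v → q v ∧ p v) xs ≤ countL p xs
countL-∧≤ q p xs = ≤-trans (m≤m+n _ _) (≤-reflexive (≡-sym (countL-split q p xs)))

countL≤length : ∀ (p : A → Bool) xs → countL p xs ≤ length xs
countL≤length p [] = z≤n
countL≤length p (x ∷ xs) with p x
... | true  = s≤s (countL≤length p xs)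
... | false = m≤n⇒m≤1+n (countL≤length p xs)

countL-true : ∀ (xs : List A) → countL (λ _ → true) xs ≡ length xs
countL-true []       = refl
countL-true (x ∷ xs) = cong suc (countL-true xs)

length-allFin : ∀ n → length (allFin n) ≡ n
length-allFin n = length-tabulate {n = n} (λ i → i)

∑< : ℕ → (ℕ → ℕ) → ℕ
∑< zero    h = 0
∑< (suc r) h = h 0 + ∑< r (h ∘ suc)

∏< : ℕ → (ℕ → ℕ) → ℕ
∏< zero    h = 1
∏< (suc r) h = h 0 * ∏< r (h ∘ suc)

∑<-cong : ∀ r {f g : ℕ → ℕ} → (∀ j → j < r → f j ≡ g j) → ∑< r f ≡ ∑< r g
∑<-cong zero    f≡g = refl
∑<-cong (suc r) f≡g = cong₂ _+_ (f≡g 0 z<s) (∑<-cong r (λ j j<r → f≡g (suc j) (s<s j<r)))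

∏<-cong : ∀ r {f g : ℕ → ℕ} → (∀ j → j < r → f j ≡ g j) → ∏< r f ≡ ∏< r g
∏<-cong zero    f≡g = refl
∏<-cong (suc r) f≡g = cong₂ _*_ (f≡g 0 z<s) (∏<-cong r (λ j j<r → f≡g (suc j) (s<s j<r)))

∑<-mono : ∀ r {f g : ℕ → ℕ} → (∀ j → f j ≤ g j) → ∑< r f ≤ ∑< r g
∑<-mono zero    f≤g = z≤n
∑<-mono (suc r) f≤g = +-mono-≤ (f≤g 0) (∑<-mono r (f≤g ∘ suc))

∑<-snoc : ∀ r h → ∑< (suc r) h ≡ ∑< r h + h r
∑<-snoc zero    h = +-comm (h 0) 0
∑<-snoc (suc r) h rewrite ∑<-snoc r (h ∘ suc) = ≡-sym (+-assoc (h 0) _ _)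

∏<-snoc : ∀ r h → ∏< (suc r) h ≡ ∏< r h * h r
∏<-snoc zero    h = trans (*-identityʳ _) (≡-sym (*-identityˡ _))
∏<-snoc (suc r) h rewrite ∏<-snoc r (h ∘ suc) = ≡-sym (*-assoc (h 0) _ _)

∑<-const : ∀ r c → ∑< r (λ _ → c) ≡ r * c
∑<-const zero    c = refl
∑<-const (suc r) c = cong (c +_) (∑<-const r c)

∏<-const : ∀ r c → ∏< r (λ _ → c) ≡ c ^ r
∏<-const zero    c = refl
∏<-const (suc r) c = cong (c *_) (∏<-const r c)

∑<-+ : ∀ r f g → ∑< r (λ j → f j + g j) ≡ ∑< r f + ∑< r g
∑<-+ zero    f g = refl
∑<-+ (suc r) f g rewrite ∑<-+ r (f ∘ suc) (g ∘ suc) = +-interchange (f 0) (g 0) _ _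

∏<-* : ∀ r f g → ∏< r (λ j → f j * g j) ≡ ∏< r f * ∏< r g
∏<-* zero    f g = refl
∏<-* (suc r) f g rewrite ∏<-* r (f ∘ suc) (g ∘ suc) = *-interchange (f 0) (g 0) _ _

∑<-*ˡ : ∀ r c f → ∑< r (λ j → c * f j) ≡ c * ∑< r f
∑<-*ˡ zero    c f = ≡-sym (*-zeroʳ c)
∑<-*ˡ (suc r) c f rewrite ∑<-*ˡ r c (f ∘ suc) = ≡-sym (*-distribˡ-+ c (f 0) _)

sumL-∑< : ∀ r (f : ℕ → A → ℕ) xs → sumL (λ x → ∑< r (λ k → f k x)) xs ≡ ∑< r (λ k → sumL (f k) xs)
sumL-∑< zero    f xs = sumL-zero xs (λ _ → refl)
sumL-∑< (suc r) f xs =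
  trans (sumL-+ (f 0) (λ x → ∑< r (λ k → f (suc k) x)) xs) (cong (sumL (f 0) xs +_) (sumL-∑< r (f ∘ suc) xs))

∏<-rotate : ∀ r (φ : ℕ → ℕ) k → ∏< (suc r) (λ j → φ ((j + k) % suc r)) ≡ ∏< (suc r) φ
∏<-rotate r φ zero = ∏<-cong (suc r) (λ j j<r → cong φ (trans (cong (_% suc r) (+-identityʳ j)) (m<n⇒m%n≡m j<r)))
∏<-rotate r φ (suc k) = begin-equality
  ∏< (suc r) (λ j → φ ((j + suc k) % suc r))
    ≡⟨ ∏<-cong (suc r) (λ j _ → cong (λ i → φ (i % suc r)) (+-suc j k)) ⟩
  ∏< (suc r) (ψ ∘ suc)
    ≡⟨ ∏<-snoc r (ψ ∘ suc) ⟩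
  ∏< r (ψ ∘ suc) * ψ (suc r)
    ≡⟨ cong (λ i → ∏< r (ψ ∘ suc) * φ i) (trans (cong (_% suc r) (+-comm (suc r) k)) ([m+n]%n≡m%n k (suc r))) ⟩
  ∏< r (ψ ∘ suc) * ψ 0
    ≡⟨ *-comm _ (ψ 0) ⟩
  ∏< (suc r) ψ
    ≡⟨ ∏<-rotate r φ k ⟩
  ∏< (suc r) φ ∎
  where
  ψ : ℕ → ℕ
  ψ j = φ ((j + k) % suc r)

-- AM–GM and Hölder

rearrangement-sorted : ∀ k {a b} → a ≤ b → b * a ^ k + a * b ^ k ≤ a * a ^ k + b * b ^ k
rearrangement-sorted k {a} a≤b with m≤n⇒∃[o]m+o≡n a≤b
... | d , refl = begin
  (a + d) * a ^ k + a * (a + d) ^ k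
    ≡⟨ cong (_+ a * (a + d) ^ k) (*-distribʳ-+ (a ^ k) a d) ⟩
  a * a ^ k + d * a ^ k + a * (a + d) ^ k
    ≤⟨ +-monoˡ-≤ _ (+-monoʳ-≤ (a * a ^ k) (*-monoʳ-≤ d (^-monoˡ-≤ k (m≤m+n a d)))) ⟩
  a * a ^ k + d * (a + d) ^ k + a * (a + d) ^ k
    ≡⟨ regroup (a * a ^ k) (d * (a + d) ^ k) (a * (a + d) ^ k) ⟩
  a * a ^ k + (a * (a + d) ^ k + d * (a + d) ^ k)
    ≡⟨ cong (a * a ^ k +_) (*-distribʳ-+ ((a + d) ^ k) a d) ⟨
  a * a ^ k + (a + d) * (a + d) ^ k ∎
  where
  regroup : ∀ x y z → x + y + z ≡ x + (z + y)
  regroup = solve-∀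

rearrangement : ∀ k a b → b * a ^ k + a * b ^ k ≤ a * a ^ k + b * b ^ k
rearrangement k a b with ≤-total a b
... | inj₁ a≤b = rearrangement-sorted k a≤b
... | inj₂ b≤a = begin
  b * a ^ k + a * b ^ k ≡⟨ +-comm (b * a ^ k) _ ⟩
  a * b ^ k + b * a ^ k ≤⟨ rearrangement-sorted k b≤a ⟩
  b * b ^ k + a * a ^ k ≡⟨ +-comm (b * b ^ k) _ ⟩
  a * a ^ k + b * b ^ k ∎

young : ∀ m a b → suc m * a * b ^ m ≤ a ^ suc m + m * b ^ suc m
young zero    a b = ≤-reflexive (trans (*-identityʳ (a + 0)) (cong (_+ 0) (≡-sym (*-identityʳ a))))
young (suc m) a b = begin
  suc (suc m) * a * b ^ suc m
    ≡⟨ split m a b (b ^ m) ⟩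
  b * (suc m * a * b ^ m) + a * b ^ suc m
    ≤⟨ +-monoˡ-≤ _ (*-monoʳ-≤ b (young m a b)) ⟩
  b * (a ^ suc m + m * b ^ suc m) + a * b ^ suc m
    ≡⟨ regroup m a b (a ^ m) (b ^ m) ⟩
  (b * a ^ suc m + a * b ^ suc m) + m * b ^ suc (suc m)
    ≤⟨ +-monoˡ-≤ _ (rearrangement (suc m) a b) ⟩
  (a ^ suc (suc m) + b ^ suc (suc m)) + m * b ^ suc (suc m)
    ≡⟨ collect m a b (a ^ m) (b ^ m) ⟩
  a ^ suc (suc m) + suc m * b ^ suc (suc m) ∎
  where
  split : ∀ m a b p → suc (suc m) * a * (b * p) ≡ b * (suc m * a * p) + a * (b * p)
  split = solve-∀
  regroup : ∀ m a b p q → b * (a * p + m * (b * q)) + a * (b * q) ≡ (b * (a * p) + a * (b * q)) + m * (b * (b * q))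
  regroup = solve-∀
  collect : ∀ m a b p q → (a * (a * p) + b * (b * q)) + m * (b * (b * q)) ≡ a * (a * p) + suc m * (b * (b * q))
  collect = solve-∀

amgm : ∀ r (a : ℕ → ℕ) → r * ∏< r a ≤ ∑< r (λ k → a k ^ r)
amgm zero          a = z≤n
amgm (suc zero)    a = ≤-reflexive (trans (+-identityʳ _) (≡-sym (+-identityʳ _)))
amgm (suc (suc m)) a = *-cancelˡ-≤ (suc m) (begin
  suc m * (r * ∏< r a)
    ≡⟨ cong (λ z → suc m * (r * z)) (∏<-snoc (suc m) a) ⟩
  suc m * (r * (∏< (suc m) a * c))
    ≡⟨ regroup (suc m) (∏< (suc m) a) c ⟩
  r * c * (suc m * ∏< (suc m) a)
    ≤⟨ *-monoʳ-≤ (r * c) (amgm (suc m) a) ⟩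
  r * c * ∑< (suc m) (λ k → a k ^ suc m)
    ≡⟨ ∑<-*ˡ (suc m) (r * c) (λ k → a k ^ suc m) ⟨
  ∑< (suc m) (λ k → r * c * a k ^ suc m)
    ≤⟨ ∑<-mono (suc m) (λ k → young (suc m) c (a k)) ⟩
  ∑< (suc m) (λ k → c ^ r + suc m * a k ^ r)
    ≡⟨ ∑<-+ (suc m) (λ _ → c ^ r) (λ k → suc m * a k ^ r) ⟩
  ∑< (suc m) (λ _ → c ^ r) + ∑< (suc m) (λ k → suc m * a k ^ r)
    ≡⟨ cong₂ _+_ (∑<-const (suc m) (c ^ r)) (∑<-*ˡ (suc m) (suc m) (λ k → a k ^ r)) ⟩
  suc m * c ^ r + suc m * ∑< (suc m) (λ k → a k ^ r)
    ≡⟨ *-distribˡ-+ (suc m) (c ^ r) _ ⟨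
  suc m * (c ^ r + ∑< (suc m) (λ k → a k ^ r))
    ≡⟨ cong (suc m *_) (trans (+-comm (c ^ r) _) (≡-sym (∑<-snoc (suc m) (λ k → a k ^ r)))) ⟩
  suc m * ∑< r (λ k → a k ^ r) ∎)
  where
  r c : ℕ
  r = suc (suc m)
  c = a (suc m)
  regroup : ∀ m p c → m * (suc m * (p * c)) ≡ suc m * c * (m * p)
  regroup = solve-∀

tuples : ∀ r → List A → List (Vec A r)
tuples zero    xs = []v ∷ []
tuples (suc r) xs = concatMap (λ x → map (x ∷v_) (tuples r xs)) xs

∏ᵥ : ∀ {r} → (ℕ → A → ℕ) → Vec A r → ℕ
∏ᵥ g []v       = 1
∏ᵥ g (x ∷v xs) = g 0 x * ∏ᵥ (g ∘ suc) xs

∏ᵥ-cong : ∀ {r} {g h : ℕ → A → ℕ} (xs : Vec A r) →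
  (∀ j → j < r → ∀ x → g j x ≡ h j x) → ∏ᵥ g xs ≡ ∏ᵥ h xs
∏ᵥ-cong []v       g≡h = refl
∏ᵥ-cong (x ∷v xs) g≡h = cong₂ _*_ (g≡h 0 z<s x) (∏ᵥ-cong xs (λ j j<r → g≡h (suc j) (s<s j<r)))

∏<-∏ᵥ : ∀ {r} k (g : ℕ → ℕ → A → ℕ) (xs : Vec A r) →
  ∏< k (λ i → ∏ᵥ (g i) xs) ≡ ∏ᵥ (λ j x → ∏< k (λ i → g i j x)) xs
∏<-∏ᵥ k g []v       = trans (∏<-const k 1) (^-zeroˡ k)
∏<-∏ᵥ k g (x ∷v xs) = trans (∏<-* k (λ i → g i 0 x) (λ i → ∏ᵥ (g i ∘ suc) xs))
  (cong (∏< k (λ i → g i 0 x) *_) (∏<-∏ᵥ k (λ i → g i ∘ suc) xs))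

∏ᵥ-^ : ∀ {r} k (g : ℕ → A → ℕ) (xs : Vec A r) → ∏ᵥ g xs ^ k ≡ ∏ᵥ (λ j x → g j x ^ k) xs
∏ᵥ-^ k g xs = begin-equality
  ∏ᵥ g xs ^ k                           ≡⟨ ∏<-const k (∏ᵥ g xs) ⟨
  ∏< k (λ _ → ∏ᵥ g xs)                  ≡⟨ ∏<-∏ᵥ k (λ _ → g) xs ⟩
  ∏ᵥ (λ j x → ∏< k (λ _ → g j x)) xs    ≡⟨ ∏ᵥ-cong xs (λ j _ x → ∏<-const k (g j x)) ⟩
  ∏ᵥ (λ j x → g j x ^ k) xs ∎

sumL-tuples-∏ᵥ : ∀ r (g : ℕ → A → ℕ) xs → sumL (∏ᵥ g) (tuples r xs) ≡ ∏< r (λ j → sumL (g j) xs)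
sumL-tuples-∏ᵥ zero    g xs = refl
sumL-tuples-∏ᵥ (suc r) g xs = begin-equality
  sumL (∏ᵥ g) (concatMap (λ x → map (x ∷v_) (tuples r xs)) xs)
    ≡⟨ sumL-concatMap (∏ᵥ g) _ xs ⟩
  sumL (λ x → sumL (∏ᵥ g) (map (x ∷v_) (tuples r xs))) xs
    ≡⟨ sumL-cong xs (λ x → trans (sumL-map (∏ᵥ g) (x ∷v_) (tuples r xs))
                                 (sumL-*ˡ (g 0 x) (∏ᵥ (g ∘ suc)) (tuples r xs))) ⟩
  sumL (λ x → g 0 x * sumL (∏ᵥ (g ∘ suc)) (tuples r xs)) xs
    ≡⟨ sumL-*ʳ _ (g 0) xs ⟩
  sumL (g 0) xs * sumL (∏ᵥ (g ∘ suc)) (tuples r xs)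
    ≡⟨ cong (sumL (g 0) xs *_) (sumL-tuples-∏ᵥ r (g ∘ suc) xs) ⟩
  sumL (g 0) xs * ∏< r (λ j → sumL (g (suc j)) xs) ∎

-- S^r is a sum over r-tuples y of ∏_j h(y_j) with h = ∏_k f_k, which regroups as the product of the
-- r cyclic rotations k ↦ ∏_j f_{(j+k) mod r}(y_j); apply AM–GM to these r factors.
holder : ∀ r (f : ℕ → A → ℕ) xs →
  sumL (λ x → ∏< r (λ j → f j x)) xs ^ r ≤ ∏< r (λ j → sumL (λ x → f j x ^ r) xs)
holder zero            f xs = ≤-refl
holder {A} r@(suc r-1) f xs = *-cancelˡ-≤ r (begin
  r * S ^ r
    ≡⟨ cong (r *_) (trans (sumL-tuples-∏ᵥ r (λ _ → h) xs) (∏<-const r S)) ⟨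
  r * sumL (∏ᵥ (λ _ → h)) T
    ≡⟨ sumL-*ˡ r (∏ᵥ (λ _ → h)) T ⟨
  sumL (λ y → r * ∏ᵥ (λ _ → h) y) T
    ≡⟨ sumL-cong T (λ y → cong (r *_) (h-rotations y)) ⟩
  sumL (λ y → r * ∏< r (λ k → ∏ᵥ (f⟳ k) y)) T
    ≤⟨ sumL-mono T (λ y → amgm r (λ k → ∏ᵥ (f⟳ k) y)) ⟩
  sumL (λ y → ∑< r (λ k → ∏ᵥ (f⟳ k) y ^ r)) T
    ≡⟨ sumL-∑< r (λ k y → ∏ᵥ (f⟳ k) y ^ r) T ⟩
  ∑< r (λ k → sumL (λ y → ∏ᵥ (f⟳ k) y ^ r) T)
    ≡⟨ ∑<-cong r (λ k _ → rotation-sum k) ⟩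
  ∑< r (λ _ → ∏< r norm)
    ≡⟨ ∑<-const r _ ⟩
  r * ∏< r norm ∎)
  where
  S : ℕ
  T : List (Vec A r)
  S = sumL (λ x → ∏< r (λ j → f j x)) xs
  T = tuples r xs
  h : A → ℕ
  h x = ∏< r (λ j → f j x)
  f⟳ : ℕ → ℕ → A → ℕ
  f⟳ k j = f ((j + k) % r)
  norm : ℕ → ℕ
  norm j = sumL (λ x → f j x ^ r) xs
  h-rotations : ∀ y → ∏ᵥ (λ _ → h) y ≡ ∏< r (λ k → ∏ᵥ (f⟳ k) y)
  h-rotations y = begin-equality
    ∏ᵥ (λ _ → h) y
      ≡⟨ ∏ᵥ-cong y (λ j _ x → ∏<-rotate r-1 (λ i → f i x) j) ⟨
    ∏ᵥ (λ j x → ∏< r (λ k → f ((k + j) % r) x)) y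
      ≡⟨ ∏ᵥ-cong y (λ j _ x → ∏<-cong r (λ k _ → cong (λ i → f (i % r) x) (+-comm k j))) ⟩
    ∏ᵥ (λ j x → ∏< r (λ k → f⟳ k j x)) y
      ≡⟨ ∏<-∏ᵥ r f⟳ y ⟨
    ∏< r (λ k → ∏ᵥ (f⟳ k) y) ∎
  rotation-sum : ∀ k → sumL (λ y → ∏ᵥ (f⟳ k) y ^ r) T ≡ ∏< r norm
  rotation-sum k = begin-equality
    sumL (λ y → ∏ᵥ (f⟳ k) y ^ r) T             ≡⟨ sumL-cong T (∏ᵥ-^ r (f⟳ k)) ⟩
    sumL (∏ᵥ (λ j x → f⟳ k j x ^ r)) T         ≡⟨ sumL-tuples-∏ᵥ r (λ j x → f⟳ k j x ^ r) xs ⟩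
    ∏< r (λ j → norm ((j + k) % r))            ≡⟨ ∏<-rotate r-1 norm k ⟩
    ∏< r norm ∎

∑Fin : ∀ b → (Fin b → ℕ) → ℕ
∑Fin zero    g = 0
∑Fin (suc b) g = g fz + ∑Fin b (g ∘ fs)

∏Fin : ∀ b → (Fin b → ℕ) → ℕ
∏Fin zero    g = 1
∏Fin (suc b) g = g fz * ∏Fin b (g ∘ fs)

∑Fin-cong : ∀ b {f g : Fin b → ℕ} → (∀ j → f j ≡ g j) → ∑Fin b f ≡ ∑Fin b g
∑Fin-cong zero    f≡g = refl
∑Fin-cong (suc b) f≡g = cong₂ _+_ (f≡g fz) (∑Fin-cong b (f≡g ∘ fs))

∏Fin-cong : ∀ b {f g : Fin b → ℕ} → (∀ j → f j ≡ g j) → ∏Fin b f ≡ ∏Fin b g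
∏Fin-cong zero    f≡g = refl
∏Fin-cong (suc b) f≡g = cong₂ _*_ (f≡g fz) (∏Fin-cong b (f≡g ∘ fs))

∏Fin-mono : ∀ b {f g : Fin b → ℕ} → (∀ j → f j ≤ g j) → ∏Fin b f ≤ ∏Fin b g
∏Fin-mono zero    f≤g = ≤-refl
∏Fin-mono (suc b) f≤g = *-mono-≤ (f≤g fz) (∏Fin-mono b (f≤g ∘ fs))

∏Fin-const : ∀ b c → ∏Fin b (λ _ → c) ≡ c ^ b
∏Fin-const zero    c = refl
∏Fin-const (suc b) c = cong (c *_) (∏Fin-const b c)

∏Fin-* : ∀ b (f g : Fin b → ℕ) → ∏Fin b (λ j → f j * g j) ≡ ∏Fin b f * ∏Fin b g
∏Fin-* zero    f g = refl
∏Fin-* (suc b) f g rewrite ∏Fin-* b (f ∘ fs) (g ∘ fs) = *-interchange (f fz) (g fz) _ _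

∏Fin-^ : ∀ b k (f : Fin b → ℕ) → ∏Fin b f ^ k ≡ ∏Fin b (λ j → f j ^ k)
∏Fin-^ b zero    f = ≡-sym (trans (∏Fin-const b 1) (^-zeroˡ b))
∏Fin-^ b (suc k) f = trans (cong (∏Fin b f *_) (∏Fin-^ b k f)) (≡-sym (∏Fin-* b f (λ j → f j ^ k)))

∏Fin-^ʳ : ∀ b c (g : Fin b → ℕ) → ∏Fin b (λ j → c ^ g j) ≡ c ^ ∑Fin b g
∏Fin-^ʳ zero    c g = refl
∏Fin-^ʳ (suc b) c g = trans (cong (c ^ g fz *_) (∏Fin-^ʳ b c (g ∘ fs))) (≡-sym (^-distribˡ-+-* c (g fz) _))

sumL-allFin : ∀ b (g : Fin b → ℕ) → sumL g (allFin b) ≡ ∑Fin b g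
sumL-allFin b g = go b g (λ i → i)
  where
  go : ∀ b (g : A → ℕ) (f : Fin b → A) → sumL g (tabulate f) ≡ ∑Fin b (g ∘ f)
  go zero    g f = refl
  go (suc b) g f = cong (g (f fz) +_) (go b g (f ∘ fs))

padFin : ∀ {b} → ℕ → (Fin b → ℕ) → ℕ → ℕ
padFin {zero}  d g j       = d
padFin {suc b} d g zero    = g fz
padFin {suc b} d g (suc j) = padFin d (g ∘ fs) j

∏<-padFin : ∀ b u d (g : Fin b → ℕ) → ∏< (b + u) (padFin d g) ≡ ∏Fin b g * d ^ u
∏<-padFin zero    u d g = trans (∏<-const u d) (≡-sym (*-identityˡ _))
∏<-padFin (suc b) u d g =
  trans (cong (g fz *_) (∏<-padFin b u d (g ∘ fs))) (≡-sym (*-assoc (g fz) _ _))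

sumL-padFin-^ : ∀ {b} (f : Fin b → A → ℕ) k xs j →
  sumL (λ x → padFin 1 (λ i → f i x) j ^ k) xs ≡ padFin (length xs) (λ i → sumL (λ x → f i x ^ k) xs) j
sumL-padFin-^ {b = zero}  f k xs j       = trans (sumL-cong xs (λ _ → ^-zeroˡ k)) (trans (sumL-const 1 xs) (*-identityʳ _))
sumL-padFin-^ {b = suc b} f k xs zero    = refl
sumL-padFin-^ {b = suc b} f k xs (suc j) = sumL-padFin-^ (f ∘ fs) k xs j

holder-padded : ∀ b u (f : Fin b → A → ℕ) xs →
  sumL (λ x → ∏Fin b (λ j → f j x)) xs ^ (b + u)
    ≤ ∏Fin b (λ j → sumL (λ x → f j x ^ (b + u)) xs) * length xs ^ u
holder-padded b u f xs = begin
  sumL (λ x → ∏Fin b (λ j → f j x)) xs ^ (b + u)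
    ≡⟨ cong (_^ (b + u)) (sumL-cong xs padded) ⟨
  sumL (λ x → ∏< (b + u) (padFin 1 (λ i → f i x))) xs ^ (b + u)
    ≤⟨ holder (b + u) (λ j x → padFin 1 (λ i → f i x) j) xs ⟩
  ∏< (b + u) (λ j → sumL (λ x → padFin 1 (λ i → f i x) j ^ (b + u)) xs)
    ≡⟨ ∏<-cong (b + u) (λ j _ → sumL-padFin-^ f (b + u) xs j) ⟩
  ∏< (b + u) (padFin (length xs) (λ i → sumL (λ x → f i x ^ (b + u)) xs))
    ≡⟨ ∏<-padFin b u (length xs) _ ⟩
  ∏Fin b (λ j → sumL (λ x → f j x ^ (b + u)) xs) * length xs ^ u ∎
  where
  padded : ∀ x → ∏< (b + u) (padFin 1 (λ i → f i x)) ≡ ∏Fin b (λ j → f j x)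
  padded x = trans (∏<-padFin b u 1 (λ j → f j x))
    (trans (cong (∏Fin b (λ j → f j x) *_) (^-zeroˡ u)) (*-identityʳ _))

power-mean : ∀ u (g : A → ℕ) xs → sumL g xs ^ suc u ≤ sumL (λ x → g x ^ suc u) xs * length xs ^ u
power-mean u g xs = begin
  sumL g xs ^ suc u
    ≡⟨ cong (_^ suc u) (sumL-cong xs (λ x → *-identityʳ (g x))) ⟨
  sumL (λ x → ∏Fin 1 (λ _ → g x)) xs ^ (1 + u)
    ≤⟨ holder-padded 1 u (λ _ → g) xs ⟩
  ∏Fin 1 (λ _ → sumL (λ x → g x ^ suc u) xs) * length xs ^ u
    ≡⟨ cong (_* length xs ^ u) (*-identityʳ (sumL (λ x → g x ^ suc u) xs)) ⟩
  sumL (λ x → g x ^ suc u) xs * length xs ^ u ∎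

*-sumL-^-≤ : ∀ K k (c : A → ℕ) xs →
  K * sumL (λ x → c x ^ k) xs ≤ K ^ suc k * length xs + sumL (λ x → c x ^ suc k) xs
*-sumL-^-≤ K k c xs = begin
  K * sumL (λ x → c x ^ k) xs                          ≡⟨ sumL-*ˡ K _ xs ⟨
  sumL (λ x → K * c x ^ k) xs                          ≤⟨ sumL-mono xs (λ x → *-^-≤ K (c x) k) ⟩
  sumL (λ x → K ^ suc k + c x ^ suc k) xs              ≡⟨ sumL-+ (λ _ → K ^ suc k) _ xs ⟩
  sumL (λ _ → K ^ suc k) xs + sumL (λ x → c x ^ suc k) xs
    ≡⟨ cong (_+ sumL (λ x → c x ^ suc k) xs) (trans (sumL-const _ xs) (*-comm (length xs) _)) ⟩
  K ^ suc k * length xs + sumL (λ x → c x ^ suc k) xs ∎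

andFin : ∀ b → (Fin b → Bool) → Bool
andFin zero    g = true
andFin (suc b) g = g fz ∧ andFin b (g ∘ fs)

andFin-true : ∀ b → andFin b (λ _ → true) ≡ true
andFin-true zero    = refl
andFin-true (suc b) = andFin-true b

andFin-cong : ∀ b {f g : Fin b → Bool} → (∀ j → f j ≡ g j) → andFin b f ≡ andFin b g
andFin-cong zero    f≡g = refl
andFin-cong (suc b) f≡g = cong₂ _∧_ (f≡g fz) (andFin-cong b (f≡g ∘ fs))

andFin-∧ : ∀ b (g h : Fin b → Bool) → andFin b g ∧ andFin b h ≡ andFin b (λ j → g j ∧ h j)
andFin-∧ zero    g h = refl
andFin-∧ (suc b) g h =
  trans (∧-interchange (g fz) _ (h fz) _) (cong ((g fz ∧ h fz) ∧_) (andFin-∧ b (g ∘ fs) (h ∘ fs)))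

andFin-swap : ∀ a b (f : Fin a → Fin b → Bool) →
  andFin a (λ i → andFin b (f i)) ≡ andFin b (λ j → andFin a (λ i → f i j))
andFin-swap zero    b f = ≡-sym (andFin-true b)
andFin-swap (suc a) b f = trans (cong (andFin b (f fz) ∧_) (andFin-swap a b (f ∘ fs)))
  (andFin-∧ b (f fz) (λ j → andFin a (λ i → f (fs i) j)))

andFin-elim : ∀ b (g : Fin b → Bool) → andFin b g ≡ true → ∀ j → g j ≡ true
andFin-elim (suc b) g all-g j with g fz in g0
andFin-elim (suc b) g all-g fz     | true = g0
andFin-elim (suc b) g all-g (fs j) | true = andFin-elim b (g ∘ fs) all-g j

andL-allFin : ∀ b (p : Fin b → Bool) → andL p (allFin b) ≡ andFin b p
andL-allFin b p = go b p (λ i → i)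
  where
  go : ∀ b (p : A → Bool) (f : Fin b → A) → andL p (tabulate f) ≡ andFin b (p ∘ f)
  go zero    p f = refl
  go (suc b) p f = cong (p (f fz) ∧_) (go b p (f ∘ fs))

sumL-allVecs-∷ : ∀ r n (F : Vec (Fin n) (suc r) → ℕ) →
  sumL F (allVecs (suc r) n) ≡ sumL (λ x → sumL (λ xs → F (x ∷v xs)) (allVecs r n)) (allFin n)
sumL-allVecs-∷ r n F =
  trans (sumL-concatMap F _ (allFin n)) (sumL-cong (allFin n) (λ x → sumL-map F (x ∷v_) (allVecs r n)))

sumL-allVecs-++ : ∀ a b n (F : Vec (Fin n) (a + b) → ℕ) →
  sumL F (allVecs (a + b) n) ≡ sumL (λ x → sumL (λ y → F (x ++v y)) (allVecs b n)) (allVecs a n)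
sumL-allVecs-++ zero    b n F = ≡-sym (+-identityʳ _)
sumL-allVecs-++ (suc a) b n F = begin-equality
  sumL F (allVecs (suc a + b) n)
    ≡⟨ sumL-allVecs-∷ (a + b) n F ⟩
  sumL (λ x₀ → sumL (λ xs → F (x₀ ∷v xs)) (allVecs (a + b) n)) (allFin n)
    ≡⟨ sumL-cong (allFin n) (λ x₀ → sumL-allVecs-++ a b n (F ∘ (x₀ ∷v_))) ⟩
  sumL (λ x₀ → sumL (λ x → sumL (λ y → F ((x₀ ∷v x) ++v y)) (allVecs b n)) (allVecs a n)) (allFin n)
    ≡⟨ sumL-allVecs-∷ a n (λ x → sumL (λ y → F (x ++v y)) (allVecs b n)) ⟨
  sumL (λ x → sumL (λ y → F (x ++v y)) (allVecs b n)) (allVecs (suc a) n) ∎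

length-allVecs : ∀ r n → length (allVecs r n) ≡ n ^ r
length-allVecs r n = trans (≡-sym (trans (sumL-const 1 (allVecs r n)) (*-identityʳ _))) (count r)
  where
  count : ∀ r → sumL (λ _ → 1) (allVecs r n) ≡ n ^ r
  count zero    = refl
  count (suc r) = begin-equality
    sumL (λ _ → 1) (allVecs (suc r) n)                        ≡⟨ sumL-allVecs-∷ r n (λ _ → 1) ⟩
    sumL (λ _ → sumL (λ _ → 1) (allVecs r n)) (allFin n)      ≡⟨ sumL-cong (allFin n) (λ _ → count r) ⟩
    sumL (λ _ → n ^ r) (allFin n)                             ≡⟨ sumL-const (n ^ r) (allFin n) ⟩
    length (allFin n) * n ^ r                                 ≡⟨ cong (_* n ^ r) (length-allFin n) ⟩
    n * n ^ r ∎

countVecs-pointwise : ∀ b n (p : Fin b → Fin n → Bool) →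
  sumL (λ y → ind (andFin b (λ j → p j (lookup y j)))) (allVecs b n) ≡ ∏Fin b (λ j → countL (p j) (allFin n))
countVecs-pointwise zero    n p = refl
countVecs-pointwise (suc b) n p = begin-equality
  sumL (λ y → ind (all p y)) (allVecs (suc b) n)
    ≡⟨ sumL-allVecs-∷ b n (λ y → ind (all p y)) ⟩
  sumL (λ x → sumL (λ y → ind (p fz x ∧ all (p ∘ fs) y)) (allVecs b n)) (allFin n)
    ≡⟨ sumL-cong (allFin n) (λ x → trans (sumL-cong (allVecs b n) (λ y → ind-∧ (p fz x) _))
                                         (sumL-*ˡ (ind (p fz x)) (λ y → ind (all (p ∘ fs) y)) (allVecs b n))) ⟩
  sumL (λ x → ind (p fz x) * sumL (λ y → ind (all (p ∘ fs) y)) (allVecs b n)) (allFin n)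
    ≡⟨ sumL-*ʳ _ (ind ∘ p fz) (allFin n) ⟩
  sumL (ind ∘ p fz) (allFin n) * sumL (λ y → ind (all (p ∘ fs) y)) (allVecs b n)
    ≡⟨ cong₂ _*_ (≡-sym (countL≡sumL-ind (p fz) (allFin n))) (countVecs-pointwise b n (p ∘ fs)) ⟩
  countL (p fz) (allFin n) * ∏Fin b (λ j → countL (p (fs j)) (allFin n)) ∎
  where
  all : ∀ {b} → (Fin b → Fin n → Bool) → Vec (Fin n) b → Bool
  all {b} p y = andFin b (λ j → p j (lookup y j))

_==_ : ∀ {n} → Fin n → Fin n → Bool
u == v = ⌊ u ≟F v ⌋

==-refl : ∀ {n} (u : Fin n) → u == u ≡ true
==-refl u with u ≟F u
... | yes _   = refl
... | no  u≢u = ⊥-elim (u≢u refl)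

==-sym : ∀ {n} (u v : Fin n) → u == v ≡ v == u
==-sym u v with u ≟F v | v ≟F u
... | yes _   | yes _   = refl
... | no  _   | no  _   = refl
... | yes u≡v | no  v≢u = ⊥-elim (v≢u (≡-sym u≡v))
... | no  u≢v | yes v≡u = ⊥-elim (u≢v (≡-sym v≡u))

==-suc : ∀ {n} (u v : Fin n) → fs u == fs v ≡ u == v
==-suc u v with u ≟F v
... | yes _ = refl
... | no  _ = refl

∑Fin-== : ∀ m (v : Fin m) → ∑Fin m (λ u → ind (u == v)) ≡ 1
∑Fin-== (suc m) fz     = cong suc (trans (∑Fin-cong m (λ _ → refl)) (∑Fin-zero m))
  where
  ∑Fin-zero : ∀ m → ∑Fin m (λ _ → 0) ≡ 0
  ∑Fin-zero zero    = refl
  ∑Fin-zero (suc m) = ∑Fin-zero m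
∑Fin-== (suc m) (fs v) = trans (∑Fin-cong m (λ u → cong ind (==-suc u v))) (∑Fin-== m v)

allSatisfy : ∀ {r n} → (Fin n → Bool) → Vec (Fin n) r → Bool
allSatisfy {r} p x = andFin r (λ l → p (lookup x l))

countVecs-allSatisfy : ∀ r n (p : Fin n → Bool) →
  sumL (ind ∘ allSatisfy p) (allVecs r n) ≡ countL p (allFin n) ^ r
countVecs-allSatisfy r n p = trans (countVecs-pointwise r n (λ _ → p)) (∏Fin-const r (countL p (allFin n)))

countVecs-collision≤ : ∀ r n (p : Fin n → Bool) (i j : Fin (suc r)) → i ≢ j →
  sumL (λ x → ind (lookup x i == lookup x j) * ind (allSatisfy p x)) (allVecs (suc r) n) ≤ countL p (allFin n) ^ r
countVecs-collision≤ r n p fz fz i≢j = ⊥-elim (i≢j refl)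
countVecs-collision≤ r n p fz (fs j) _ = begin
  sumL F (allVecs (suc r) n)
    ≡⟨ sumL-allVecs-∷ r n F ⟩
  sumL (λ x₀ → sumL (λ x → F (x₀ ∷v x)) (allVecs r n)) V
    ≤⟨ sumL-mono V (λ x₀ → sumL-mono (allVecs r n) (λ x →
         *-monoʳ-≤ (ind (x₀ == lookup x j)) (drop-head x₀ x))) ⟩
  sumL (λ x₀ → sumL (λ x → ind (x₀ == lookup x j) * ind (allSatisfy p x)) (allVecs r n)) V
    ≡⟨ sumL-swap _ V (allVecs r n) ⟩
  sumL (λ x → sumL (λ x₀ → ind (x₀ == lookup x j) * ind (allSatisfy p x)) V) (allVecs r n)
    ≡⟨ sumL-cong (allVecs r n) (λ x → trans (sumL-*ʳ _ _ V) (cong (_* ind (allSatisfy p x)) (unique (lookup x j)))) ⟩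
  sumL (λ x → 1 * ind (allSatisfy p x)) (allVecs r n)
    ≡⟨ trans (sumL-cong (allVecs r n) (λ x → *-identityˡ _)) (countVecs-allSatisfy r n p) ⟩
  countL p V ^ r ∎
  where
  V : List (Fin n)
  V = allFin n
  F : Vec (Fin n) (suc r) → ℕ
  F x = ind (lookup x fz == lookup x (fs j)) * ind (allSatisfy p x)
  drop-head : ∀ x₀ (x : Vec (Fin n) r) → ind (p x₀ ∧ allSatisfy p x) ≤ ind (allSatisfy p x)
  drop-head x₀ x = ≤-trans (≤-reflexive (ind-∧ (p x₀) _))
    (≤-trans (*-monoˡ-≤ _ (ind≤1 (p x₀))) (≤-reflexive (*-identityˡ _)))
  unique : ∀ v → sumL (λ u → ind (u == v)) V ≡ 1
  unique v = trans (sumL-allFin n _) (∑Fin-== n v)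
countVecs-collision≤ r n p (fs i) fz _ = begin
  sumL (λ x → ind (lookup x (fs i) == lookup x fz) * ind (allSatisfy p x)) (allVecs (suc r) n)
    ≡⟨ sumL-cong (allVecs (suc r) n) (λ x →
         cong (λ b → ind b * ind (allSatisfy p x)) (==-sym (lookup x (fs i)) (lookup x fz))) ⟩
  sumL (λ x → ind (lookup x fz == lookup x (fs i)) * ind (allSatisfy p x)) (allVecs (suc r) n)
    ≤⟨ countVecs-collision≤ r n p fz (fs i) (λ ()) ⟩
  countL p (allFin n) ^ r ∎
countVecs-collision≤ (suc r) n p (fs i) (fs j) fsi≢fsj = begin
  sumL F (allVecs (suc (suc r)) n)
    ≡⟨ sumL-allVecs-∷ (suc r) n F ⟩
  sumL (λ x₀ → sumL (λ x → F (x₀ ∷v x)) (allVecs (suc r) n)) V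
    ≡⟨ sumL-cong V (λ x₀ → trans (sumL-cong (allVecs (suc r) n) (λ x → pull (x₀ ∷v x)))
                                 (sumL-*ˡ (ind (p x₀)) (G ∘ (x₀ ∷v_)) (allVecs (suc r) n))) ⟩
  sumL (λ x₀ → ind (p x₀) * sumL (λ x → G (x₀ ∷v x)) (allVecs (suc r) n)) V
    ≤⟨ sumL-mono V (λ x₀ → *-monoʳ-≤ (ind (p x₀)) (countVecs-collision≤ r n p i j (fsi≢fsj ∘ cong fs))) ⟩
  sumL (λ x₀ → ind (p x₀) * countL p V ^ r) V
    ≡⟨ sumL-*ʳ _ (ind ∘ p) V ⟩
  sumL (ind ∘ p) V * countL p V ^ r
    ≡⟨ cong (_* countL p V ^ r) (countL≡sumL-ind p V) ⟨
  countL p V ^ suc r ∎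
  where
  V : List (Fin n)
  V = allFin n
  F G : Vec (Fin n) (suc (suc r)) → ℕ
  F x = ind (lookup x (fs i) == lookup x (fs j)) * ind (allSatisfy p x)
  G (_ ∷v x) = ind (lookup x i == lookup x j) * ind (allSatisfy p x)
  pull : ∀ x → F x ≡ ind (p (lookup x fz)) * G x
  pull (x₀ ∷v x) = trans (cong (ind (lookup x i == lookup x j) *_) (ind-∧ (p x₀) _))
                         (*-left-comm (ind (lookup x i == lookup x j)) (ind (p x₀)) (ind (allSatisfy p x)))

-- Homomorphism counts

rightDegree : ∀ {a b} → BipEdges a b → Fin b → ℕ
rightDegree {a} E j = ∑Fin a (λ i → ind (E i j))

bipEdgeCount≡∑Fin-rightDegree : ∀ a b (E : BipEdges a b) → bipEdgeCount E ≡ ∑Fin b (rightDegree E)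
bipEdgeCount≡∑Fin-rightDegree a b E = begin-equality
  sumL (λ i → countL (E i) (allFin b)) (allFin a)
    ≡⟨ sumL-cong (allFin a) (λ i → countL≡sumL-ind (E i) (allFin b)) ⟩
  sumL (λ i → sumL (λ j → ind (E i j)) (allFin b)) (allFin a)
    ≡⟨ sumL-swap (λ i j → ind (E i j)) (allFin a) (allFin b) ⟩
  sumL (λ j → sumL (λ i → ind (E i j)) (allFin a)) (allFin b)
    ≡⟨ sumL-cong (allFin b) (λ j → sumL-allFin a (λ i → ind (E i j))) ⟩
  sumL (rightDegree E) (allFin b)
    ≡⟨ sumL-allFin b (rightDegree E) ⟩
  ∑Fin b (rightDegree E) ∎

bipEdgeCount≤ : ∀ a b (E : BipEdges a b) → bipEdgeCount E ≤ a * b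
bipEdgeCount≤ a b E = begin
  sumL (λ i → countL (E i) (allFin b)) (allFin a)
    ≤⟨ sumL-mono (allFin a) (λ i → ≤-trans (countL≤length (E i) (allFin b)) (≤-reflexive (length-allFin b))) ⟩
  sumL (λ _ → b) (allFin a)
    ≡⟨ trans (sumL-const b (allFin a)) (cong (_* b) (length-allFin a)) ⟩
  a * b ∎

module Homomorphisms {n : ℕ} (G : Graph n) where

  V : List (Fin n)
  V = allFin n

  hom : ∀ a b → BipEdges a b → ℕ
  hom a b E = countL (preservesᵇ G E) (allVecs (a + b) n)

  labelledCopies≤hom : ∀ a b E → labelledCopies G a b E ≤ hom a b E
  labelledCopies≤hom a b E = countL-∧≤ injectiveᵇ (preservesᵇ G E) (allVecs (a + b) n)

  preservesPair : ∀ {a b} → BipEdges a b → Vec (Fin n) a → Vec (Fin n) b → Bool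
  preservesPair {a} {b} E x y = andFin a (λ i → andFin b (λ j → not (E i j) ∨ adj G (lookup x i) (lookup y j)))

  preservesᵇ-++ : ∀ a b (E : BipEdges a b) x y → preservesᵇ G E (x ++v y) ≡ preservesPair E x y
  preservesᵇ-++ a b E x y = trans (andL-allFin a _) (andFin-cong a (λ i → trans (andL-allFin b _)
    (andFin-cong b (λ j → cong₂ (λ u v → not (E i j) ∨ adj G u v) (lookup-++ˡ x y i) (lookup-++ʳ x y j)))))

  hom-split : ∀ a b E → hom a b E ≡ sumL (λ x → sumL (λ y → ind (preservesPair E x y)) (allVecs b n)) (allVecs a n)
  hom-split a b E = trans (countL≡sumL-ind _ (allVecs (a + b) n)) (trans (sumL-allVecs-++ a b n _)
    (sumL-cong (allVecs a n) (λ x → sumL-cong (allVecs b n) (λ y → cong ind (preservesᵇ-++ a b E x y)))))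

  rightExtensions : ∀ {a b} → BipEdges a b → Vec (Fin n) a → Fin b → ℕ
  rightExtensions {a} E x j = countL (λ z → andFin a (λ i → not (E i j) ∨ adj G (lookup x i) z)) V

  leftExtensions : ∀ {a b} → BipEdges a b → Vec (Fin n) b → Fin a → ℕ
  leftExtensions {b = b} E y i = countL (λ z → andFin b (λ j → not (E i j) ∨ adj G z (lookup y j))) V

  hom-by-left : ∀ a b E → hom a b E ≡ sumL (λ x → ∏Fin b (rightExtensions E x)) (allVecs a n)
  hom-by-left a b E = trans (hom-split a b E) (sumL-cong (allVecs a n) (λ x →
    trans (sumL-cong (allVecs b n) (λ y → cong ind (andFin-swap a b _)))
          (countVecs-pointwise b n (λ j z → andFin a (λ i → not (E i j) ∨ adj G (lookup x i) z)))))

  hom-by-right : ∀ a b E → hom a b E ≡ sumL (λ y → ∏Fin a (leftExtensions E y)) (allVecs b n)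
  hom-by-right a b E = trans (hom-split a b E) (trans (sumL-swap _ (allVecs a n) (allVecs b n))
    (sumL-cong (allVecs b n) (λ y →
      countVecs-pointwise a n (λ i z → andFin b (λ j → not (E i j) ∨ adj G z (lookup y j))))))

  homK : ℕ → ℕ → ℕ
  homK s t = hom s t (completeBip s t)

  codegreeʳ : ∀ {t} → Vec (Fin n) t → ℕ
  codegreeʳ {t} y = countL (λ z → andFin t (λ k → adj G z (lookup y k))) V

  codegreeˡ : ∀ {s} → Vec (Fin n) s → ℕ
  codegreeˡ {s} x = countL (λ z → andFin s (λ i → adj G (lookup x i) z)) V

  homK-by-left : ∀ s t → homK s t ≡ sumL (λ x → codegreeˡ x ^ t) (allVecs s n)
  homK-by-left s t = trans (hom-by-left s t (completeBip s t)) (sumL-cong (allVecs s n) (λ x → ∏Fin-const t (codegreeˡ x)))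

  homK-by-right : ∀ s t → homK s t ≡ sumL (λ y → codegreeʳ y ^ s) (allVecs t n)
  homK-by-right s t = trans (hom-by-right s t (completeBip s t))
    (sumL-cong (allVecs t n) (λ y → ∏Fin-const s (codegreeʳ y)))

  module _ {a b : ℕ} (w u : ℕ) (E : BipEdges a b) where

    private
      s t M : ℕ
      s = a + w
      t = b + u
      M = n ^ t * n ^ s

    columnPower : Fin b → ℕ
    columnPower j = sumL (λ x → rightExtensions E x j ^ t) (allVecs a n)

    -- Column j counts homomorphisms of the star joining N_L(j) to t right vertices; Hölder over the
    -- right tuples gives each left vertex i a factor hom(K_{s,t}) if i ∈ N_L(j) and n^{s+t} otherwise.
    column-bound : ∀ j → columnPower j ^ s * M ^ rightDegree E j ≤ homK s t ^ rightDegree E j * M ^ a * (n ^ t) ^ w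
    column-bound j = begin
      columnPower j ^ s * M ^ deg
        ≡⟨ cong (λ z → z ^ s * M ^ deg) star-by-right ⟩
      sumL (λ y → ∏Fin a (leftExtensions star y)) (allVecs t n) ^ (a + w) * M ^ deg
        ≤⟨ *-monoˡ-≤ (M ^ deg) (holder-padded a w (λ i y → leftExtensions star y i) (allVecs t n)) ⟩
      ∏Fin a g * length (allVecs t n) ^ w * M ^ deg
        ≡⟨ cong (λ z → ∏Fin a g * z ^ w * M ^ deg) (length-allVecs t n) ⟩
      ∏Fin a g * (n ^ t) ^ w * M ^ deg
        ≡⟨ *-right-comm (∏Fin a g) ((n ^ t) ^ w) (M ^ deg) ⟩
      ∏Fin a g * M ^ deg * (n ^ t) ^ w
        ≡⟨ cong (λ z → ∏Fin a g * z * (n ^ t) ^ w) (∏Fin-^ʳ a M (λ i → ind (E i j))) ⟨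
      ∏Fin a g * ∏Fin a (λ i → M ^ ind (E i j)) * (n ^ t) ^ w
        ≡⟨ cong (_* (n ^ t) ^ w) (∏Fin-* a g (λ i → M ^ ind (E i j))) ⟨
      ∏Fin a (λ i → g i * M ^ ind (E i j)) * (n ^ t) ^ w
        ≡⟨ cong (_* (n ^ t) ^ w) (∏Fin-cong a g-balance) ⟩
      ∏Fin a (λ i → homK s t ^ ind (E i j) * M) * (n ^ t) ^ w
        ≡⟨ cong (_* (n ^ t) ^ w) (trans (∏Fin-* a (λ i → homK s t ^ ind (E i j)) (λ _ → M))
                                        (cong₂ _*_ (∏Fin-^ʳ a (homK s t) (λ i → ind (E i j))) (∏Fin-const a M))) ⟩
      homK s t ^ deg * M ^ a * (n ^ t) ^ w ∎
      where
      deg : ℕ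
      deg = rightDegree E j
      star : BipEdges a t
      star i _ = E i j
      star-by-right : columnPower j ≡ sumL (λ y → ∏Fin a (leftExtensions star y)) (allVecs t n)
      star-by-right = trans (sumL-cong (allVecs a n) (λ x → ≡-sym (∏Fin-const t (rightExtensions E x j))))
                            (trans (≡-sym (hom-by-left a t star)) (hom-by-right a t star))
      g : Fin a → ℕ
      g i = sumL (λ y → leftExtensions star y i ^ s) (allVecs t n)
      extensions : ∀ β y → countL (λ z → andFin t (λ k → not β ∨ adj G z (lookup y k))) V
                         ≡ (if β then codegreeʳ y else n)
      extensions true  y = refl
      extensions false y = trans (countL-cong V (λ _ → andFin-true t)) (trans (countL-true V) (length-allFin n))
      balance : ∀ β → sumL (λ y → (if β then codegreeʳ y else n) ^ s) (allVecs t n) * M ^ ind β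
                    ≡ homK s t ^ ind β * M
      balance true  = cong₂ _*_ (trans (≡-sym (homK-by-right s t)) (≡-sym (*-identityʳ _))) (*-identityʳ M)
      balance false = begin-equality
        sumL (λ _ → n ^ s) (allVecs t n) * 1  ≡⟨ *-identityʳ _ ⟩
        sumL (λ _ → n ^ s) (allVecs t n)      ≡⟨ sumL-const (n ^ s) (allVecs t n) ⟩
        length (allVecs t n) * n ^ s          ≡⟨ cong (_* n ^ s) (length-allVecs t n) ⟩
        M                                     ≡⟨ *-identityˡ M ⟨
        1 * M ∎
      g-balance : ∀ i → g i * M ^ ind (E i j) ≡ homK s t ^ ind (E i j) * M
      g-balance i = trans (cong (_* M ^ ind (E i j)) (sumL-cong (allVecs t n) (λ y → cong (_^ s) (extensions (E i j) y))))
                          (balance (E i j))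

    hom^t≤ : hom a b E ^ t ≤ ∏Fin b columnPower * (n ^ a) ^ u
    hom^t≤ = begin
      hom a b E ^ t
        ≡⟨ cong (_^ t) (hom-by-left a b E) ⟩
      sumL (λ x → ∏Fin b (rightExtensions E x)) (allVecs a n) ^ (b + u)
        ≤⟨ holder-padded b u (λ j x → rightExtensions E x j) (allVecs a n) ⟩
      ∏Fin b columnPower * length (allVecs a n) ^ u
        ≡⟨ cong (λ z → ∏Fin b columnPower * z ^ u) (length-allVecs a n) ⟩
      ∏Fin b columnPower * (n ^ a) ^ u ∎

    private
      powers-of-n : (M ^ a * (n ^ t) ^ w) ^ b * ((n ^ a) ^ u) ^ s ≡ n ^ ((a + b) * (s * t))
      powers-of-n = begin-equality
        (M ^ a * (n ^ t) ^ w) ^ b * ((n ^ a) ^ u) ^ s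
          ≡⟨ cong (λ z → (z ^ a * (n ^ t) ^ w) ^ b * ((n ^ a) ^ u) ^ s) (^-distribˡ-+-* n t s) ⟨
        ((n ^ (t + s)) ^ a * (n ^ t) ^ w) ^ b * ((n ^ a) ^ u) ^ s
          ≡⟨ cong₂ (λ x y → (x * y) ^ b * ((n ^ a) ^ u) ^ s) (^-*-assoc n (t + s) a) (^-*-assoc n t w) ⟩
        (n ^ ((t + s) * a) * n ^ (t * w)) ^ b * ((n ^ a) ^ u) ^ s
          ≡⟨ cong₂ (λ x y → x ^ b * y ^ s) (≡-sym (^-distribˡ-+-* n ((t + s) * a) (t * w))) (^-*-assoc n a u) ⟩
        (n ^ ((t + s) * a + t * w)) ^ b * (n ^ (a * u)) ^ s
          ≡⟨ cong₂ _*_ (^-*-assoc n ((t + s) * a + t * w) b) (^-*-assoc n (a * u) s) ⟩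
        n ^ (((t + s) * a + t * w) * b) * n ^ (a * u * s)
          ≡⟨ ^-distribˡ-+-* n (((t + s) * a + t * w) * b) (a * u * s) ⟨
        n ^ (((t + s) * a + t * w) * b + a * u * s)
          ≡⟨ cong (n ^_) (exponent a w b u) ⟩
        n ^ ((a + b) * (s * t)) ∎
        where
        exponent : ∀ a w b u → ((b + u + (a + w)) * a + (b + u) * w) * b + a * u * (a + w) ≡ (a + b) * ((a + w) * (b + u))
        exponent = solve-∀

      n^edges : n ^ (bipEdgeCount E * (s + t)) ≡ ∏Fin b (λ j → M ^ rightDegree E j)
      n^edges = begin-equality
        n ^ (e * (s + t))          ≡⟨ cong (λ z → n ^ (e * z)) (+-comm s t) ⟩
        n ^ (e * (t + s))          ≡⟨ cong (n ^_) (*-comm e (t + s)) ⟩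
        n ^ ((t + s) * e)          ≡⟨ ^-*-assoc n (t + s) e ⟨
        (n ^ (t + s)) ^ e          ≡⟨ cong (_^ e) (^-distribˡ-+-* n t s) ⟩
        M ^ e                      ≡⟨ cong (M ^_) (bipEdgeCount≡∑Fin-rightDegree a b E) ⟩
        M ^ ∑Fin b (rightDegree E) ≡⟨ ∏Fin-^ʳ b M (rightDegree E) ⟨
        ∏Fin b (λ j → M ^ rightDegree E j) ∎
        where
        e : ℕ
        e = bipEdgeCount E

    hom-holder : hom a b E ^ (s * t) * n ^ (bipEdgeCount E * (s + t)) ≤ homK s t ^ bipEdgeCount E * n ^ ((a + b) * (s * t))
    hom-holder = begin
      hom a b E ^ (s * t) * n ^ (e * (s + t))
        ≡⟨ cong₂ _*_ (trans (cong (hom a b E ^_) (*-comm s t)) (≡-sym (^-*-assoc (hom a b E) t s))) n^edges ⟩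
      (hom a b E ^ t) ^ s * ∏Fin b Mᵈ
        ≤⟨ *-monoˡ-≤ _ (^-monoˡ-≤ s hom^t≤) ⟩
      (∏Fin b T * (n ^ a) ^ u) ^ s * ∏Fin b Mᵈ
        ≡⟨ cong (_* ∏Fin b Mᵈ) (trans (^-distribʳ-* (∏Fin b T) _ s) (cong (_* Z) (∏Fin-^ b s T))) ⟩
      ∏Fin b (λ j → T j ^ s) * Z * ∏Fin b Mᵈ
        ≡⟨ *-right-comm (∏Fin b (λ j → T j ^ s)) Z _ ⟩
      ∏Fin b (λ j → T j ^ s) * ∏Fin b Mᵈ * Z
        ≡⟨ cong (_* Z) (∏Fin-* b (λ j → T j ^ s) Mᵈ) ⟨
      ∏Fin b (λ j → T j ^ s * Mᵈ j) * Z
        ≤⟨ *-monoˡ-≤ Z (∏Fin-mono b column-bound) ⟩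
      ∏Fin b (λ j → H ^ rightDegree E j * M ^ a * (n ^ t) ^ w) * Z
        ≡⟨ cong (_* Z) (∏Fin-cong b (λ j → *-assoc (H ^ rightDegree E j) (M ^ a) _)) ⟩
      ∏Fin b (λ j → H ^ rightDegree E j * (M ^ a * (n ^ t) ^ w)) * Z
        ≡⟨ cong (_* Z) (trans (∏Fin-* b (λ j → H ^ rightDegree E j) _)
                              (cong₂ _*_ (∏Fin-^ʳ b H (rightDegree E)) (∏Fin-const b _))) ⟩
      H ^ ∑Fin b (rightDegree E) * (M ^ a * (n ^ t) ^ w) ^ b * Z
        ≡⟨ cong (λ z → H ^ z * (M ^ a * (n ^ t) ^ w) ^ b * Z) (bipEdgeCount≡∑Fin-rightDegree a b E) ⟨
      H ^ e * (M ^ a * (n ^ t) ^ w) ^ b * Z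
        ≡⟨ trans (*-assoc (H ^ e) _ Z) (cong (H ^ e *_) powers-of-n) ⟩
      H ^ e * n ^ ((a + b) * (s * t)) ∎
      where
      e H Z : ℕ
      T : Fin b → ℕ
      e = bipEdgeCount E
      H = homK s t
      Z = ((n ^ a) ^ u) ^ s
      T = columnPower
      Mᵈ : Fin b → ℕ
      Mᵈ j = M ^ rightDegree E j

-- Non-injective homomorphisms of K_{s,t}

ind-not-∨-not≤ : ∀ a b → ind (not (a ∨ not b)) ≤ ind b
ind-not-∨-not≤ true  b     = z≤n
ind-not-∨-not≤ false true  = ≤-refl
ind-not-∨-not≤ false false = z≤n

ind-not-andL≤ : ∀ (f : A → Bool) xs → ind (not (andL f xs)) ≤ sumL (λ x → ind (not (f x))) xs
ind-not-andL≤ f []       = z≤n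
ind-not-andL≤ f (x ∷ xs) with f x
... | true  = ind-not-andL≤ f xs
... | false = s≤s z≤n

data Side {s t : ℕ} : Fin (s + t) → Set where
  left  : (i : Fin s) → Side (i ↑ˡ t)
  right : (j : Fin t) → Side (s ↑ʳ j)

side : ∀ s {t} (i : Fin (s + t)) → Side i
side s i with splitAt s i in eq
... | inj₁ i₁ = subst Side (splitAt⁻¹-↑ˡ eq) (left i₁)
... | inj₂ j  = subst Side (splitAt⁻¹-↑ʳ eq) (right j)

module Collisions {n : ℕ} (G : Graph n) (s' t' : ℕ) where
  open Homomorphisms G

  s t : ℕ
  s = suc s'
  t = suc t'

  private
    KB : BipEdges s t
    pres : Vec (Fin n) (s + t) → Bool
    I : List (Fin (s + t))
    KB = completeBip s t
    pres = preservesᵇ G KB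
    I = allFin (s + t)

  separated collides : Fin (s + t) → Fin (s + t) → Vec (Fin n) (s + t) → Bool
  separated i j v = i == j ∨ not (lookup v i == lookup v j)
  collides  i j v = not (separated i j v)

  collisions : Fin (s + t) → Fin (s + t) → ℕ
  collisions i j = sumL (λ v → ind (collides i j v) * ind (pres v)) (allVecs (s + t) n)

  collisions-self : ∀ i → collisions i i ≡ 0
  collisions-self i = sumL-zero (allVecs (s + t) n) (λ v →
    cong (λ b → ind (not (b ∨ not (lookup v i == lookup v i))) * ind (pres v)) (==-refl i))

  collisions≤ : ∀ i j (F : Vec (Fin n) s → Vec (Fin n) t → ℕ) →
    (∀ x y → ind (lookup (x ++v y) i == lookup (x ++v y) j) * ind (preservesPair KB x y) ≤ F x y) →
    collisions i j ≤ sumL (λ x → sumL (F x) (allVecs t n)) (allVecs s n)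
  collisions≤ i j F bound = begin
    collisions i j
      ≡⟨ sumL-allVecs-++ s t n _ ⟩
    sumL (λ x → sumL (λ y → ind (collides i j (x ++v y)) * ind (pres (x ++v y))) (allVecs t n)) (allVecs s n)
      ≤⟨ sumL-mono (allVecs s n) (λ x → sumL-mono (allVecs t n) (λ y → ≤-trans
           (*-mono-≤ (ind-not-∨-not≤ (i == j) _) (≤-reflexive (cong ind (preservesᵇ-++ s t KB x y))))
           (bound x y))) ⟩
    sumL (λ x → sumL (F x) (allVecs t n)) (allVecs s n) ∎

  cross-collision-free : ∀ x y i j → ind (lookup x i == lookup y j) * ind (preservesPair KB x y) ≡ 0
  cross-collision-free x y i j with lookup x i ≟F lookup y j
  ... | no  _     = refl
  ... | yes xᵢ≡yⱼ with preservesPair KB x y in complete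
  ...   | false = refl
  ...   | true  = ⊥-elim (true≢false (trans (≡-sym loop) (irrefl G (lookup y j))))
    where
    true≢false : true ≢ false
    true≢false ()
    loop : adj G (lookup y j) (lookup y j) ≡ true
    loop = subst (λ z → adj G z (lookup y j) ≡ true) xᵢ≡yⱼ
      (andFin-elim t (λ k → adj G (lookup x i) (lookup y k))
        (andFin-elim s (λ l → andFin t (λ k → adj G (lookup x l) (lookup y k))) complete i) j)

  collisions≤0 : ∀ i j → (∀ x y → ind (lookup (x ++v y) i == lookup (x ++v y) j) * ind (preservesPair KB x y) ≡ 0) →
    collisions i j ≤ 0
  collisions≤0 i j none = ≤-trans (collisions≤ i j (λ _ _ → 0) (λ x y → ≤-reflexive (none x y)))
    (≤-reflexive (sumL-zero (allVecs s n) (λ _ → sumL-zero (allVecs t n) (λ _ → refl))))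

  K*collisions-left≤ : ∀ K → s' ≤ t' → ∀ i₁ j₁ →
    K * collisions (i₁ ↑ˡ t) (j₁ ↑ˡ t) ≤ K ^ t * n ^ t + homK s t
  K*collisions-left≤ K s'≤t' i₁ j₁ with i₁ ≟F j₁
  ... | yes refl  = *-≤0 K _ (≤-reflexive (collisions-self (i₁ ↑ˡ t)))
  ... | no i₁≢j₁ = begin
    K * collisions (i₁ ↑ˡ t) (j₁ ↑ˡ t)
      ≤⟨ *-monoʳ-≤ K (collisions≤ _ _ F (λ x y → ≤-reflexive (cong (λ b → ind b * _)
           (cong₂ _==_ (lookup-++ˡ x y i₁) (lookup-++ˡ x y j₁))))) ⟩
    K * sumL (λ x → sumL (F x) (allVecs t n)) (allVecs s n)
      ≡⟨ cong (K *_) (sumL-swap F (allVecs s n) (allVecs t n)) ⟩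
    K * sumL (λ y → sumL (λ x → F x y) (allVecs s n)) (allVecs t n)
      ≤⟨ *-monoʳ-≤ K (sumL-mono (allVecs t n) (λ y → countVecs-collision≤ s' n _ i₁ j₁ i₁≢j₁)) ⟩
    K * sumL (λ y → codegreeʳ y ^ s') (allVecs t n)
      ≤⟨ *-sumL-^-≤ K s' codegreeʳ (allVecs t n) ⟩
    K ^ s * length (allVecs t n) + sumL (λ y → codegreeʳ y ^ s) (allVecs t n)
      ≡⟨ cong₂ _+_ (cong (K ^ s *_) (length-allVecs t n)) (≡-sym (homK-by-right s t)) ⟩
    K ^ s * n ^ t + homK s t
      ≤⟨ +-monoˡ-≤ _ (*-monoˡ-≤ _ (^-monoʳ-suc K s'≤t')) ⟩
    K ^ t * n ^ t + homK s t ∎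
    where
    F : Vec (Fin n) s → Vec (Fin n) t → ℕ
    F x y = ind (lookup x i₁ == lookup x j₁) * ind (allSatisfy (λ z → andFin t (λ k → adj G z (lookup y k))) x)

  K*collisions-right≤ : ∀ K → s' ≤ t' → ∀ i₂ j₂ →
    K * collisions (s ↑ʳ i₂) (s ↑ʳ j₂) ≤ K ^ t * n ^ t + homK s t
  K*collisions-right≤ K s'≤t' i₂ j₂ with i₂ ≟F j₂
  ... | yes refl  = *-≤0 K _ (≤-reflexive (collisions-self (s ↑ʳ i₂)))
  ... | no i₂≢j₂ = begin
    K * collisions (s ↑ʳ i₂) (s ↑ʳ j₂)
      ≤⟨ *-monoʳ-≤ K (collisions≤ _ _ F (λ x y → ≤-reflexive (cong₂ (λ b c → ind b * ind c)
           (cong₂ _==_ (lookup-++ʳ x y i₂) (lookup-++ʳ x y j₂))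
           (andFin-swap s t (λ i k → adj G (lookup x i) (lookup y k)))))) ⟩
    K * sumL (λ x → sumL (F x) (allVecs t n)) (allVecs s n)
      ≤⟨ *-monoʳ-≤ K (sumL-mono (allVecs s n) (λ x → countVecs-collision≤ t' n _ i₂ j₂ i₂≢j₂)) ⟩
    K * sumL (λ x → codegreeˡ x ^ t') (allVecs s n)
      ≤⟨ *-sumL-^-≤ K t' codegreeˡ (allVecs s n) ⟩
    K ^ t * length (allVecs s n) + sumL (λ x → codegreeˡ x ^ t) (allVecs s n)
      ≡⟨ cong₂ _+_ (cong (K ^ t *_) (length-allVecs s n)) (≡-sym (homK-by-left s t)) ⟩
    K ^ t * n ^ s + homK s t
      ≤⟨ +-monoˡ-≤ _ (*-monoʳ-≤ (K ^ t) (^-monoʳ-suc n s'≤t')) ⟩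
    K ^ t * n ^ t + homK s t ∎
    where
    F : Vec (Fin n) s → Vec (Fin n) t → ℕ
    F x y = ind (lookup y i₂ == lookup y j₂) * ind (allSatisfy (λ z → andFin s (λ i → adj G (lookup x i) z)) y)

  K*collisions≤ : ∀ K → s' ≤ t' → ∀ i j → K * collisions i j ≤ K ^ t * n ^ t + homK s t
  K*collisions≤ K s'≤t' i j with side s i | side s j
  ... | left  i₁ | left  j₁ = K*collisions-left≤ K s'≤t' i₁ j₁
  ... | right i₂ | right j₂ = K*collisions-right≤ K s'≤t' i₂ j₂
  ... | left i₁ | right j₂ = *-≤0 K _ (collisions≤0 _ _ (λ x y →
    trans (cong (λ b → ind b * _) (cong₂ _==_ (lookup-++ˡ x y i₁) (lookup-++ʳ x y j₂)))
          (cross-collision-free x y i₁ j₂)))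
  ... | right i₂ | left j₁ = *-≤0 K _ (collisions≤0 _ _ (λ x y →
    trans (cong (λ b → ind b * _) (trans (cong₂ _==_ (lookup-++ʳ x y i₂) (lookup-++ˡ x y j₁)) (==-sym _ _)))
          (cross-collision-free x y j₁ i₂)))

  nonInjective : ℕ
  nonInjective = countL (λ v → not (injectiveᵇ v) ∧ pres v) (allVecs (s + t) n)

  nonInjective≤collisions : nonInjective ≤ sumL (λ i → sumL (collisions i) I) I
  nonInjective≤collisions = begin
    nonInjective
      ≡⟨ countL≡sumL-ind _ VV ⟩
    sumL (λ v → ind (not (injectiveᵇ v) ∧ pres v)) VV
      ≡⟨ sumL-cong VV (λ v → ind-∧ (not (injectiveᵇ v)) (pres v)) ⟩
    sumL (λ v → ind (not (injectiveᵇ v)) * ind (pres v)) VV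
      ≤⟨ sumL-mono VV (λ v → *-monoˡ-≤ (ind (pres v))
           (≤-trans (ind-not-andL≤ (λ i → andL (λ j → separated i j v) I) I)
                    (sumL-mono I (λ i → ind-not-andL≤ (λ j → separated i j v) I)))) ⟩
    sumL (λ v → sumL (λ i → sumL (λ j → ind (collides i j v)) I) I * ind (pres v)) VV
      ≡⟨ sumL-cong VV (λ v → trans (≡-sym (sumL-*ʳ (ind (pres v)) (λ i → sumL (λ j → ind (collides i j v)) I) I))
                                   (sumL-cong I (λ i →
                                      ≡-sym (sumL-*ʳ (ind (pres v)) (λ j → ind (collides i j v)) I)))) ⟩
    sumL (λ v → sumL (λ i → sumL (λ j → ind (collides i j v) * ind (pres v)) I) I) VV
      ≡⟨ sumL-swap _ VV I ⟩
    sumL (λ i → sumL (λ v → sumL (λ j → ind (collides i j v) * ind (pres v)) I) VV) I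
      ≡⟨ sumL-cong I (λ i → sumL-swap _ VV I) ⟩
    sumL (λ i → sumL (collisions i) I) I ∎
    where
    VV : List (Vec (Fin n) (s + t))
    VV = allVecs (s + t) n

  K*nonInjective≤ : ∀ K → s' ≤ t' → K * nonInjective ≤ (s + t) * ((s + t) * (K ^ t * n ^ t + homK s t))
  K*nonInjective≤ K s'≤t' = begin
    K * nonInjective
      ≤⟨ *-monoʳ-≤ K nonInjective≤collisions ⟩
    K * sumL (λ i → sumL (collisions i) I) I
      ≡⟨ trans (sumL-cong I (λ i → sumL-*ˡ K _ I)) (sumL-*ˡ K _ I) ⟨
    sumL (λ i → sumL (λ j → K * collisions i j) I) I
      ≤⟨ sumL-mono I (λ i → sumL-mono I (K*collisions≤ K s'≤t' i)) ⟩
    sumL (λ _ → sumL (λ _ → W) I) I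
      ≡⟨ trans (sumL-const _ I) (cong₂ _*_ (length-allFin (s + t))
           (trans (sumL-const W I) (cong (_* W) (length-allFin (s + t))))) ⟩
    (s + t) * ((s + t) * W) ∎
    where
    W : ℕ
    W = K ^ t * n ^ t + homK s t

  -- Each of the (s+t)² position pairs contributes at most (K^t n^t + hom)/K ≤ 2 hom/K.
  copies-dominate : ∀ m → s' ≤ t' → (2 * (suc m * ((s + t) * (s + t)))) ^ t * n ^ t ≤ homK s t →
    m * homK s t ≤ (m + 1) * labelledCopies G s t KB
  copies-dominate m s'≤t' homK-large =
    subst (λ k → m * homK s t ≤ k * copies) (+-comm 1 m) (+-cancelʳ-≤ (homK s t) _ _ (begin
    m * homK s t + homK s t
      ≡⟨ +-comm (m * homK s t) _ ⟩
    suc m * homK s t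
      ≡⟨ cong (suc m *_) (countL-split injectiveᵇ pres (allVecs (s + t) n)) ⟩
    suc m * (copies + nonInjective)
      ≡⟨ *-distribˡ-+ (suc m) copies nonInjective ⟩
    suc m * copies + suc m * nonInjective
      ≤⟨ +-monoʳ-≤ (suc m * copies) few-nonInjective ⟩
    suc m * copies + homK s t ∎))
    where
    Q K copies : ℕ
    Q = (s + t) * (s + t)
    K = 2 * (suc m * Q)
    copies = labelledCopies G s t KB
    few-nonInjective : suc m * nonInjective ≤ homK s t
    few-nonInjective = *-cancelˡ-≤ (2 * Q) {{record { nonZero = _ }}} (begin
      2 * Q * (suc m * nonInjective)
        ≡⟨ reassoc Q (suc m) nonInjective ⟩
      K * nonInjective
        ≤⟨ K*nonInjective≤ K s'≤t' ⟩
      (s + t) * ((s + t) * (K ^ t * n ^ t + homK s t))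
        ≤⟨ *-monoʳ-≤ (s + t) (*-monoʳ-≤ (s + t) (+-monoˡ-≤ (homK s t) homK-large)) ⟩
      (s + t) * ((s + t) * (homK s t + homK s t))
        ≡⟨ double (s + t) (homK s t) ⟩
      2 * Q * homK s t ∎)
      where
      reassoc : ∀ Q m b → 2 * Q * (m * b) ≡ 2 * (m * Q) * b
      reassoc = solve-∀
      double : ∀ x h → x * (x * (h + h)) ≡ 2 * (x * x) * h
      double = solve-∀

-- Edge density

module Density {n : ℕ} (G : Graph n) where
  open Homomorphisms G

  degree : Fin n → ℕ
  degree z = countL (λ w → adj G w z) V

  edgeCount≤sumL-degree : edgeCount G ≤ sumL degree V
  edgeCount≤sumL-degree = sumL-mono V (λ i → ≤-trans (countL-∧≤ (λ j → toℕ i <ᵇ toℕ j) (adj G i) V)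
                                                    (≤-reflexive (countL-cong V (Graph.sym G i))))

  sumL-codegreeˡ : ∀ s → sumL codegreeˡ (allVecs s n) ≡ sumL (λ z → degree z ^ s) V
  sumL-codegreeˡ s = begin-equality
    sumL codegreeˡ (allVecs s n)
      ≡⟨ sumL-cong (allVecs s n) (λ x → countL≡sumL-ind _ V) ⟩
    sumL (λ x → sumL (λ z → ind (allSatisfy (λ w → adj G w z) x)) V) (allVecs s n)
      ≡⟨ sumL-swap _ (allVecs s n) V ⟩
    sumL (λ z → sumL (λ x → ind (allSatisfy (λ w → adj G w z) x)) (allVecs s n)) V
      ≡⟨ sumL-cong V (λ z → countVecs-allSatisfy s n (λ w → adj G w z)) ⟩
    sumL (λ z → degree z ^ s) V ∎

  edgeCount^st≤ : ∀ s' t' → let s = suc s' ; t = suc t' in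
    edgeCount G ^ (s * t) ≤ homK s t * n ^ (s * t' + s' * t)
  edgeCount^st≤ s' t' = begin
    e ^ (s * t)
      ≡⟨ ^-*-assoc e s t ⟨
    (e ^ s) ^ t
      ≤⟨ ^-monoˡ-≤ t e^s≤ ⟩
    (sumL codegreeˡ (allVecs s n) * n ^ s') ^ t
      ≡⟨ ^-distribʳ-* (sumL codegreeˡ (allVecs s n)) (n ^ s') t ⟩
    sumL codegreeˡ (allVecs s n) ^ t * (n ^ s') ^ t
      ≤⟨ *-monoˡ-≤ ((n ^ s') ^ t) (power-mean t' codegreeˡ (allVecs s n)) ⟩
    sumL (λ x → codegreeˡ x ^ t) (allVecs s n) * length (allVecs s n) ^ t' * (n ^ s') ^ t
      ≡⟨ cong₂ (λ h l → h * l ^ t' * (n ^ s') ^ t) (≡-sym (homK-by-left s t)) (length-allVecs s n) ⟩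
    homK s t * (n ^ s) ^ t' * (n ^ s') ^ t
      ≡⟨ *-assoc (homK s t) _ _ ⟩
    homK s t * ((n ^ s) ^ t' * (n ^ s') ^ t)
      ≡⟨ cong (homK s t *_) (trans (cong₂ _*_ (^-*-assoc n s t') (^-*-assoc n s' t))
                                   (≡-sym (^-distribˡ-+-* n (s * t') (s' * t)))) ⟩
    homK s t * n ^ (s * t' + s' * t) ∎
    where
    s t e : ℕ
    s = suc s'
    t = suc t'
    e = edgeCount G
    e^s≤ : e ^ s ≤ sumL codegreeˡ (allVecs s n) * n ^ s'
    e^s≤ = begin
      e ^ s                                        ≤⟨ ^-monoˡ-≤ s edgeCount≤sumL-degree ⟩
      sumL degree V ^ s                            ≤⟨ power-mean s' degree V ⟩
      sumL (λ z → degree z ^ s) V * length V ^ s'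
        ≡⟨ cong₂ (λ a b → a * b ^ s') (≡-sym (sumL-codegreeˡ s)) (length-allFin n) ⟩
      sumL codegreeˡ (allVecs s n) * n ^ s' ∎

  -- Raise the density assumption to the power s and insert edgeCount^st≤: since
  -- s((2t−1)q + tp) = (2st−s−t)q + tq + stp, this gives (n^t)^q n^{stp} ≤ hom^q, and n^{stp} ≥ n ≥ (K^t)^q.
  homK-large : ∀ s' t' p' q' K → let s = suc s' ; t = suc t' ; p = suc p' ; q = suc q' in
    1 ≤ n → (K ^ t) ^ q ≤ n →
    n ^ ((2 * t ∸ 1) * q + t * p) ≤ edgeCount G ^ (t * q) →
    K ^ t * n ^ t ≤ homK s t
  homK-large s' t' p' q' K 1≤n Kᵗᵠ≤n dense = ^-cancelˡ-≤ q' (begin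
    (K ^ t * n ^ t) ^ q            ≡⟨ ^-distribʳ-* (K ^ t) (n ^ t) q ⟩
    (K ^ t) ^ q * (n ^ t) ^ q      ≤⟨ *-mono-≤ (≤-trans Kᵗᵠ≤n n≤n^stp) (≤-reflexive (^-*-assoc n t q)) ⟩
    n ^ (s * t * p) * n ^ (t * q)  ≡⟨ *-comm (n ^ (s * t * p)) _ ⟩
    n ^ (t * q) * n ^ (s * t * p)  ≤⟨ *-cancelˡ-≤ ((n ^ P) ^ q) {{m^n≢0 (n ^ P) q {{m^n≢0 n P}}}} key ⟩
    homK s t ^ q ∎)
    where
    s t p q P X e : ℕ
    s = suc s'
    t = suc t'
    p = suc p'
    q = suc q'
    P = s * t' + s' * t
    X = (2 * t ∸ 1) * q + t * p
    e = edgeCount G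
    instance
      n≢0 : NonZero n
      n≢0 = >-nonZero 1≤n
    n≤n^stp : n ≤ n ^ (s * t * p)
    n≤n^stp = ≤-trans (≤-reflexive (≡-sym (*-identityʳ n))) (^-monoʳ-≤ n {1} {s * t * p} (s≤s z≤n))
    exponent : X * s ≡ P * q + (t * q + s * t * p)
    exponent = exponent-identity s' t' p' q'
      where
      exponent-identity : ∀ s' t' p' q' → ((t' + suc (t' + 0)) * suc q' + suc t' * suc p') * suc s'
        ≡ (suc s' * t' + s' * suc t') * suc q' + (suc t' * suc q' + suc s' * suc t' * suc p')
      exponent-identity = solve-∀
    key : (n ^ P) ^ q * (n ^ (t * q) * n ^ (s * t * p)) ≤ (n ^ P) ^ q * homK s t ^ q
    key = begin
      (n ^ P) ^ q * (n ^ (t * q) * n ^ (s * t * p))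
        ≡⟨ cong₂ _*_ (^-*-assoc n P q) (≡-sym (^-distribˡ-+-* n (t * q) (s * t * p))) ⟩
      n ^ (P * q) * n ^ (t * q + s * t * p) ≡⟨ ^-distribˡ-+-* n (P * q) _ ⟨
      n ^ (P * q + (t * q + s * t * p))     ≡⟨ cong (n ^_) exponent ⟨
      n ^ (X * s)                           ≡⟨ ^-*-assoc n X s ⟨
      (n ^ X) ^ s                           ≤⟨ ^-monoˡ-≤ s dense ⟩
      (e ^ (t * q)) ^ s                     ≡⟨ trans (^-*-assoc e (t * q) s) (cong (e ^_) (rotate t q s)) ⟩
      e ^ (s * t * q)                       ≡⟨ ^-*-assoc e (s * t) q ⟨
      (e ^ (s * t)) ^ q                     ≤⟨ ^-monoˡ-≤ q (edgeCount^st≤ s' t') ⟩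
      (homK s t * n ^ P) ^ q                ≡⟨ trans (^-distribʳ-* (homK s t) (n ^ P) q) (*-comm (homK s t ^ q) _) ⟩
      (n ^ P) ^ q * homK s t ^ q ∎
      where
      rotate : ∀ t q s → t * q * s ≡ s * t * q
      rotate = solve-∀

copies-bound : ∀ {n} (G : Graph n) {a b s t} (E : BipEdges a b) → a ≤ s → b ≤ t → ∀ m →
  let open Homomorphisms G ; copiesK = labelledCopies G s t (completeBip s t) in
  m * homK s t ≤ (m + 1) * copiesK →
  m ^ (s * t) * labelledCopies G a b E ^ (s * t) * n ^ (bipEdgeCount E * (s + t))
    ≤ (m + 1) ^ (s * t) * copiesK ^ bipEdgeCount E * n ^ ((a + b) * (s * t))
copies-bound {n} G {a} {b} E a≤s b≤t m m*homK≤ with m≤n⇒∃[o]m+o≡n a≤s | m≤n⇒∃[o]m+o≡n b≤t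
... | w , refl | u , refl = begin
  m ^ st * labelledCopies G a b E ^ st * n ^ (e * (s + t))
    ≤⟨ *-monoˡ-≤ _ (*-monoʳ-≤ (m ^ st) (^-monoˡ-≤ st (labelledCopies≤hom a b E))) ⟩
  m ^ st * hom a b E ^ st * n ^ (e * (s + t))
    ≡⟨ *-assoc (m ^ st) _ _ ⟩
  m ^ st * (hom a b E ^ st * n ^ (e * (s + t)))
    ≤⟨ *-monoʳ-≤ (m ^ st) (hom-holder w u E) ⟩
  m ^ st * (homK s t ^ e * n ^ ((a + b) * st))
    ≡⟨ *-assoc (m ^ st) _ _ ⟨
  m ^ st * homK s t ^ e * n ^ ((a + b) * st)
    ≤⟨ *-monoˡ-≤ _ (*-^-mono-≤ e st e≤st (m≤m+n m 1) m*homK≤) ⟩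
  (m + 1) ^ st * labelledCopies G s t (completeBip s t) ^ e * n ^ ((a + b) * st) ∎
  where
  open Homomorphisms G
  s t st e : ℕ
  s = a + w
  t = b + u
  st = s * t
  e = bipEdgeCount E
  e≤st : e ≤ st
  e≤st = ≤-trans (bipEdgeCount≤ a b E) (*-mono-≤ (m≤m+n a w) (m≤m+n b u))

lemma4p1 : (s t : ℕ) → 1 ≤ s → s ≤ t →
    -- δ = p / q > 0
    (p q : ℕ) → 0 < p → 0 < q →
    -- L ⊆ K_{s,t} with a left vertices, b right vertices, edges E
    (a b : ℕ) → a ≤ s → b ≤ t → (E : BipEdges a b) →
    -- ε = 1 / m
    (m : ℕ) → 1 ≤ m →
    ∃[ N ] ((n : ℕ) → N ≤ n → (G : Graph n) →
      -- e(G) ≥ n ^ (2 - 1/t + p/q), raised to the power t q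
      n ^ ((2 * t ∸ 1) * q + t * p) ≤ edgeCount G ^ (t * q) →
      -- copies(L) ≤ (1 + 1/m) λ^{e(L)/(st)} n^{v(L)} with λ n^{s+t} = copies(K_{s,t}),
      -- raised to the power s t and cleared of denominators
      m ^ (s * t) * labelledCopies G a b E ^ (s * t) * n ^ (bipEdgeCount E * (s + t))
        ≤ (m + 1) ^ (s * t) * labelledCopies G s t (completeBip s t) ^ bipEdgeCount E
          * n ^ ((a + b) * (s * t)))
lemma4p1 zero     _        ()
lemma4p1 (suc s') zero     _  ()
lemma4p1 (suc s') (suc t') _  _           zero     _        ()
lemma4p1 (suc s') (suc t') _  _           (suc p') zero     _ ()
lemma4p1 (suc s') (suc t') _  _           (suc p') (suc q') _ _ _ _ _   _   _ zero     ()
lemma4p1 (suc s') (suc t') _  (s≤s s'≤t') (suc p') (suc q') _ _ a b a≤s b≤t E (suc m') _ =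
  N , λ n N≤n G dense → copies-bound G E a≤s b≤t (suc m') (homK-dominated n N≤n G dense)
  where
  s t K N : ℕ
  s = suc s'
  t = suc t'
  K = 2 * (suc (suc m') * ((s + t) * (s + t)))
  N = (K ^ t) ^ suc q'
  homK-dominated : ∀ n → N ≤ n → (G : Graph n) →
    n ^ ((2 * t ∸ 1) * suc q' + t * suc p') ≤ edgeCount G ^ (t * suc q') →
    suc m' * Homomorphisms.homK G s t ≤ (suc m' + 1) * labelledCopies G s t (completeBip s t)
  homK-dominated n N≤n G dense = Collisions.copies-dominate G s' t' (suc m') s'≤t'
    (Density.homK-large G s' t' p' q' K (≤-trans (m^n>0 (K ^ t) {{m^n≢0 K t}} (suc q')) N≤n) N≤n dense)
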